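{- Let $H=S_1\cup S_2\cup\cdots\cup S_k$ be a graph with more than one connected component, each of which is a star (with at least one edge). Then for every integer $t\geq e(H)$, $\operatorname{sat}_t(n,\mathfrak{R}(H))\leq O(n)$ as $n\to\infty$.
   Context: A star is $K_{1,k}$. A $t$-edge-coloured graph is a graph $G$ with a function $c:E(G)\to\{1,\dots,t\}$ (not necessarily proper). A copy of $H$ is rainbow if all its edges receive distinct colours; $\mathfrak{R}(H)$ denotes the family of rainbow copies of $H$. A $t$-edge-coloured graph is $\mathfrak{R}(H)$-saturated if it contains no rainbow copy of $H$ but adding any non-edge in any colour from $\{1,\dots,t\}$ creates a rainbow copy of $H$. $\operatorname{sat}_t(n,\mathfrak{R}(H))$ is the minimum number of edges of such a graph on $n$ vertices. -}

module Defs where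

open import Data.Nat using (ℕ; zero; suc; _+_; _*_; _≤_; _<ᵇ_)
open import Data.Fin using (Fin; toℕ; _≟_)
import Data.Fin as F
open import Data.List using (List; map; allFin)
open import Data.Nat.ListAction using (sum)
open import Data.Maybe using (Maybe; just; nothing; is-just)
open import Data.Bool using (Bool; true; false; if_then_else_; _∧_; _∨_)
open import Data.Product using (Σ; ∃; ∃-syntax; _×_; _,_)
open import Relation.Binary.PropositionalEquality using (_≡_; _≢_; refl)
open import Relation.Nullary using (¬_; does; yes; no)
open import Data.Empty using (⊥-elim)
open import Data.Bool.Properties using (∧-comm; ∨-comm)
open import Function.Definitions using (Injective)

-- A t-edge-coloured (simple) graph on the vertex set Fin n:
-- col u v = nothing  means uv is not an edge,
-- col u v = just a   means uv is an edge of colour a ∈ {1..t} (encoded as Fin t).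
record ColGraph (n t : ℕ) : Set where
  field
    col   : Fin n → Fin n → Maybe (Fin t)
    irrefl : ∀ u → col u u ≡ nothing
    sym   : ∀ u v → col u v ≡ col v u
open ColGraph public

edgeCount : ∀ {n t} → ColGraph n t → ℕ
edgeCount {n} G =
  sum (map (λ u → sum (map (λ v →
    if (toℕ u <ᵇ toℕ v) ∧ is-just (col G u v) then 1 else 0) (allFin n))) (allFin n))

-- The graph H = S_1 ∪ ... ∪ S_k (vertex-disjoint union of stars), where S_i = K_{1, s i}.
-- Vertices of H: pairs (i , x) with x : Fin (suc (s i)); x = zero is the centre of S_i,
-- x = suc j is the j-th leaf of S_i.
HVert : (k : ℕ) → (Fin k → ℕ) → Set
HVert k s = Σ (Fin k) (λ i → Fin (suc (s i)))

-- Edges of H: pairs (i , j) with j : Fin (s i), the edge centre(i) -- leaf j of S_i.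
HEdge : (k : ℕ) → (Fin k → ℕ) → Set
HEdge k s = Σ (Fin k) (λ i → Fin (s i))

eH : (k : ℕ) → (Fin k → ℕ) → ℕ
eH k s = sum (map s (allFin k))

HasRainbowCopy : ∀ {n t} (k : ℕ) (s : Fin k → ℕ) → ColGraph n t → Set
HasRainbowCopy {n} {t} k s G =
  Σ (HVert k s → Fin n) λ f →
  Σ (HEdge k s → Fin t) λ c →
    Injective _≡_ _≡_ f ×
    Injective _≡_ _≡_ c ×
    (∀ (e : HEdge k s) → let (i , j) = e in
       col G (f (i , F.zero)) (f (i , F.suc j)) ≡ just (c e))

addEdge : ∀ {n t} → ColGraph n t → (u v : Fin n) → u ≢ v → Fin t → ColGraph n t
addEdge {n} {t} G u v u≢v a = record { col = c' ; irrefl = irr ; sym = sy }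
  where
  isUV : Fin n → Fin n → Bool
  isUV x y = (does (x ≟ u) ∧ does (y ≟ v)) ∨ (does (x ≟ v) ∧ does (y ≟ u))
  c' : Fin n → Fin n → Maybe (Fin t)
  c' x y = if isUV x y then just a else col G x y
  isUV-sym : ∀ x y → isUV x y ≡ isUV y x
  isUV-sym x y rewrite ∧-comm (does (y ≟ u)) (does (x ≟ v))
                     | ∧-comm (does (y ≟ v)) (does (x ≟ u))
                     = ∨-comm (does (x ≟ u) ∧ does (y ≟ v)) (does (x ≟ v) ∧ does (y ≟ u))
  irr : ∀ x → c' x x ≡ nothing
  irr x with x ≟ u | x ≟ v
  ... | yes refl | yes refl = ⊥-elim (u≢v refl)
  ... | yes _ | no _ = irrefl G x
  ... | no _ | yes _ = irrefl G x
  ... | no _ | no _ = irrefl G x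
  sy : ∀ x y → c' x y ≡ c' y x
  sy x y rewrite isUV-sym x y with isUV y x
  ... | true = refl
  ... | false = sym G x y

RainbowSaturated : ∀ {n t} (k : ℕ) (s : Fin k → ℕ) → ColGraph n t → Set
RainbowSaturated {n} {t} k s G =
  ¬ HasRainbowCopy k s G ×
  (∀ (u v : Fin n) (u≢v : u ≢ v) → col G u v ≡ nothing → ∀ (a : Fin t) →
     HasRainbowCopy k s (addEdge G u v u≢v a))

module Submission where

-- All graphs used are split graphs: D = {0 , … , d-1} is a clique joined to every vertex, the rest B is
-- independent.  Such a graph has at most d·n edges and all its non-edges lie in B.  To show that adding a non-edge
-- uv creates a rainbow H, it suffices to label the vertices and edges of H injectively by vertices and colours so
-- that each edge of H becomes uv (in the new colour) or an edge of the split graph of the right colour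
-- (realisation⇒rainbow).  Two constructions cover all cases:
--   * some star is a single edge: d = k - 1, edges from D to b ∈ B coloured b mod t (SingleEdgeStar);
--     a copy of H needs k vertices in D;
--   * all stars have ≥ 2 leaves: d = e(H) - 1, edges leaving D coloured by their end in D, and D cyclically
--     coloured (LargeStars); a rainbow H would need e(H) ≤ d.

open import Defs hiding (sym)
open import Data.Nat using (ℕ; zero; suc; _<ᵇ_; _+_; _*_; _∸_; _≤_; _<_; z≤n; s≤s; s≤s⁻¹; _≟_; _<?_; _≤?_; pred; NonZero; _⊓_; _⊔_)
open import Data.Nat.Properties
open import Data.Nat.DivMod using (_%_; m<n⇒m%n≡m; [m+kn]%n≡m%n)
open import Algebra.Properties.CommutativeSemigroup +-commutativeSemigroup using (xy∙z≈xz∙y)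
open import Data.Fin as Fin using (Fin; toℕ; fromℕ<; _↑ˡ_; _↑ʳ_; splitAt; join)
import Data.Fin.Properties as FinP
open import Data.Fin.Permutation.Components using (transpose; transpose-inverse)
open import Data.List using (List; []; _∷_; map; allFin; tabulate; length)
open import Data.List.Properties using (map-tabulate; length-tabulate)
open import Data.Nat.ListAction using (sum)
open import Data.Bool using (Bool; true; false; if_then_else_; _∧_; T)
import Data.Bool
open import Data.Unit using (⊤; tt)
open import Data.Maybe using (Maybe; just; nothing; is-just)
import Data.Maybe
open import Data.Product using (Σ; _×_; _,_; proj₁; proj₂)
open import Data.Product.Properties using (≡-dec)
open import Data.Sum using (_⊎_; inj₁; inj₂)
open import Data.Empty using (⊥-elim)
open import Function using (_∘_)
open import Function.Definitions using (Injective)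
open import Relation.Binary.PropositionalEquality
open import Relation.Binary.Definitions using (tri<; tri≈; tri>)
open import Relation.Nullary using (¬_; Dec; yes; no)
open import Relation.Nullary.Decidable using (_×-dec_)

-- Reading a number as an element of Fin (suc m); numbers out of range go to 0.
clamp : ∀ {m} → ℕ → Fin (suc m)
clamp {m} x with x <? suc m
... | yes x<m = fromℕ< x<m
... | no _ = Fin.zero

toℕ-clamp : ∀ {m} x → x < suc m → toℕ (clamp {m} x) ≡ x
toℕ-clamp {m} x x<m with x <? suc m
... | yes x<m' = FinP.toℕ-fromℕ< x<m'
... | no x≮m = ⊥-elim (x≮m x<m)

clamp-toℕ : ∀ {m} (u : Fin (suc m)) → clamp (toℕ u) ≡ u
clamp-toℕ u = FinP.toℕ-injective (toℕ-clamp (toℕ u) (FinP.toℕ<n u))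

clamp-injective : ∀ {m} {x y} → x < suc m → y < suc m → clamp {m} x ≡ clamp y → x ≡ y
clamp-injective {x = x} {y} x<m y<m eq =
  trans (sym (toℕ-clamp x x<m)) (trans (cong toℕ eq) (toℕ-clamp y y<m))

opaque
  avoid-two : (g : ℕ → ℕ) → (∀ m m' → g m ≡ g m' → m ≡ m') → (u v : ℕ) →
              Σ ℕ λ m → m < 3 × g m ≢ u × g m ≢ v
  avoid-two g inj u v with g 0 ≟ u | g 0 ≟ v | g 1 ≟ u | g 1 ≟ v
  ... | no g0≢u | no g0≢v | _ | _ = 0 , s≤s z≤n , g0≢u , g0≢v
  ... | _ | _ | no g1≢u | no g1≢v = 1 , s≤s (s≤s z≤n) , g1≢u , g1≢v
  ... | yes g0≡u | _ | yes g1≡u | _ = ⊥-elim (0≢1+n (inj 0 1 (trans g0≡u (sym g1≡u))))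
  ... | _ | yes g0≡v | _ | yes g1≡v = ⊥-elim (0≢1+n (inj 0 1 (trans g0≡v (sym g1≡v))))
  ... | yes g0≡u | _ | no _ | yes g1≡v =
    2 , ≤-refl , (λ e → 1+n≢0 (inj 2 0 (trans e (sym g0≡u)))) , (λ e → 1+n≢0 (suc-injective (inj 2 1 (trans e (sym g1≡v)))))
  ... | no _ | yes g0≡v | yes g1≡u | _ =
    2 , ≤-refl , (λ e → 1+n≢0 (suc-injective (inj 2 1 (trans e (sym g1≡u))))) , (λ e → 1+n≢0 (inj 2 0 (trans e (sym g0≡v))))

-- Euclidean division is unique; used to tell apart vertices chosen in the form a + K·m.
divmod-unique : ∀ {m} .{{_ : NonZero m}} a K a' K' → a < m → a' < m →
                a + K * m ≡ a' + K' * m → a ≡ a' × K ≡ K'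
divmod-unique {m} a K a' K' a<m a'<m eq = a≡a' , *-cancelʳ-≡ K K' m (+-cancelˡ-≡ a _ _ (trans eq (cong (_+ K' * m) (sym a≡a'))))
  where
  a≡a' : a ≡ a'
  a≡a' = begin
    a               ≡⟨ sym (m<n⇒m%n≡m a<m) ⟩
    a % m           ≡⟨ sym ([m+kn]%n≡m%n a K m) ⟩
    (a + K * m) % m ≡⟨ cong (_% m) eq ⟩
    (a' + K' * m) % m ≡⟨ [m+kn]%n≡m%n a' K' m ⟩
    a' % m          ≡⟨ m<n⇒m%n≡m a'<m ⟩
    a' ∎
    where open ≡-Reasoning

-- Injectivity of an embedding by "sources": if every element w is placed either at a D-resource r (label α r < d)
-- or at a B-resource b (label β b ≥ d), and each kind of resource is labelled injectively, then the labelling is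
-- injective.
module Sources {W R S : Set} (good : R → Set) (fromR : R → W) (fromS : S → W) (α : R → ℕ) (β : S → ℕ)
               (label : W → ℕ) where

  data Source (w : W) : Set where
    viaD : (r : R) → good r → w ≡ fromR r → label w ≡ α r → Source w
    viaB : (b : S) → w ≡ fromS b → label w ≡ β b → Source w

  sourced-injective : (d : ℕ) → (∀ {r} → good r → α r < d) → (∀ b → d ≤ β b) →
                      (∀ {r r'} → good r → good r' → α r ≡ α r' → r ≡ r') → (∀ {b b'} → β b ≡ β b' → b ≡ b') →
                      (∀ w → Source w) → ∀ w w' → label w ≡ label w' → w ≡ w'
  sourced-injective d α<d d≤β α-inj β-inj source w w' eq with source w | source w'
  ... | viaD r g w≡ l≡ | viaD r' g' w'≡ l'≡ =
    trans w≡ (trans (cong fromR (α-inj g g' (trans (sym l≡) (trans eq l'≡)))) (sym w'≡))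
  ... | viaB b w≡ l≡ | viaB b' w'≡ l'≡ = trans w≡ (trans (cong fromS (β-inj (trans (sym l≡) (trans eq l'≡)))) (sym w'≡))
  ... | viaD r g _ l≡ | viaB b _ l'≡ = ⊥-elim (<⇒≱ (α<d g) (subst (d ≤_) (trans (sym l'≡) (trans (sym eq) l≡)) (d≤β b)))
  ... | viaB b _ l≡ | viaD r g _ l'≡ = ⊥-elim (<⇒≱ (α<d g) (subst (d ≤_) (trans (sym l≡) (trans eq l'≡)) (d≤β b)))

edges : (k : ℕ) → (Fin k → ℕ) → ℕ
edges zero s = 0
edges (suc k) s = s Fin.zero + edges k (s ∘ Fin.suc)

eH≡edges : ∀ k s → eH k s ≡ edges k s
eH≡edges zero s = refl
eH≡edges (suc k) s = cong (s Fin.zero +_) (begin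
  sum (map s (tabulate Fin.suc))             ≡⟨ cong sum (map-tabulate Fin.suc s) ⟩
  sum (tabulate (s ∘ Fin.suc))              ≡⟨ cong sum (sym (map-tabulate (λ i → i) (s ∘ Fin.suc))) ⟩
  sum (map (s ∘ Fin.suc) (allFin k))                  ≡⟨ eH≡edges k (s ∘ Fin.suc) ⟩
  edges k (s ∘ Fin.suc) ∎)
  where open ≡-Reasoning

edgeIndex : ∀ {k s} → HEdge k s → Fin (edges k s)
edgeIndex {suc k} {s} (Fin.zero , y) = y ↑ˡ edges k (s ∘ Fin.suc)
edgeIndex {suc k} {s} (Fin.suc i , y) = s Fin.zero ↑ʳ edgeIndex (i , y)

edgeAt : ∀ {k s} → Fin (edges k s) → HEdge k s
edgeAt {suc k} {s} x = fromSplit (splitAt (s Fin.zero) x)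
  where
  fromSplit : Fin (s Fin.zero) ⊎ Fin (edges k (s ∘ Fin.suc)) → HEdge (suc k) s
  fromSplit (inj₁ y) = Fin.zero , y
  fromSplit (inj₂ x') = let (i , y) = edgeAt {k} {s ∘ Fin.suc} x' in Fin.suc i , y

edgeAt-edgeIndex : ∀ {k s} (e : HEdge k s) → edgeAt (edgeIndex e) ≡ e
edgeAt-edgeIndex {suc k} {s} (Fin.zero , y) rewrite FinP.splitAt-↑ˡ (s Fin.zero) y (edges k (s ∘ Fin.suc)) = refl
edgeAt-edgeIndex {suc k} {s} (Fin.suc i , y)
  rewrite FinP.splitAt-↑ʳ (s Fin.zero) (edges k (s ∘ Fin.suc)) (edgeIndex (i , y)) =
  cong (λ (e : HEdge k (s ∘ Fin.suc)) → (Fin.suc (proj₁ e) , proj₂ e)) (edgeAt-edgeIndex (i , y))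

edgeIndex-edgeAt : ∀ {k s} (x : Fin (edges k s)) → edgeIndex (edgeAt {k} {s} x) ≡ x
edgeIndex-edgeAt {suc k} {s} x with splitAt (s Fin.zero) x in eq
... | inj₁ y = trans (cong (join (s Fin.zero) (edges k (s ∘ Fin.suc))) (sym eq)) (FinP.join-splitAt (s Fin.zero) (edges k (s ∘ Fin.suc)) x)
... | inj₂ x' = trans (cong (s Fin.zero ↑ʳ_) (edgeIndex-edgeAt {k} {s ∘ Fin.suc} x'))
                     (trans (cong (join (s Fin.zero) (edges k (s ∘ Fin.suc))) (sym eq)) (FinP.join-splitAt (s Fin.zero) (edges k (s ∘ Fin.suc)) x))

edgeIndex-injective : ∀ {k s} {e e' : HEdge k s} → edgeIndex e ≡ edgeIndex e' → e ≡ e'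
edgeIndex-injective {e = e} {e'} eq =
  trans (sym (edgeAt-edgeIndex e)) (trans (cong edgeAt eq) (edgeAt-edgeIndex e'))

edges-pigeonhole : ∀ {k s p} (h : HEdge k s → Fin p) → Injective _≡_ _≡_ h → edges k s ≤ p
edges-pigeonhole {k} {s} h h-inj = FinP.injective⇒≤ {f = h ∘ edgeAt} λ {x} {x'} eq →
  trans (sym (edgeIndex-edgeAt {k} {s} x)) (trans (cong edgeIndex (h-inj eq)) (edgeIndex-edgeAt {k} {s} x'))

offset : ∀ {k} → (Fin k → ℕ) → Fin k → ℕ
offset s Fin.zero = 0
offset s (Fin.suc i) = s Fin.zero + offset (s ∘ Fin.suc) i

toℕ-edgeIndex : ∀ {k s} (i : Fin k) (y : Fin (s i)) → toℕ (edgeIndex {k} {s} (i , y)) ≡ offset s i + toℕ y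
toℕ-edgeIndex {suc k} {s} Fin.zero y = FinP.toℕ-↑ˡ y _
toℕ-edgeIndex {suc k} {s} (Fin.suc i) y = begin
  toℕ (s Fin.zero ↑ʳ edgeIndex (i , y))            ≡⟨ FinP.toℕ-↑ʳ (s Fin.zero) _ ⟩
  s Fin.zero + toℕ (edgeIndex {s = s ∘ Fin.suc} (i , y)) ≡⟨ cong (s Fin.zero +_) (toℕ-edgeIndex i y) ⟩
  s Fin.zero + (offset (s ∘ Fin.suc) i + toℕ y)    ≡⟨ sym (+-assoc (s Fin.zero) _ _) ⟩
  s Fin.zero + offset (s ∘ Fin.suc) i + toℕ y ∎
  where open ≡-Reasoning

offset+size≤edges : ∀ {k} s (i : Fin k) → offset s i + s i ≤ edges k s
offset+size≤edges s Fin.zero = m≤m+n _ _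
offset+size≤edges s (Fin.suc i) =
  ≤-trans (≤-reflexive (+-assoc (s Fin.zero) _ _)) (+-monoʳ-≤ (s Fin.zero) (offset+size≤edges (s ∘ Fin.suc) i))

stars-disjoint : ∀ {k} (s : Fin k → ℕ) {i j : Fin k} → i ≢ j →
                 offset s i + s i ≤ offset s j ⊎ offset s j + s j ≤ offset s i
stars-disjoint s {Fin.zero} {Fin.zero} i≢j = ⊥-elim (i≢j refl)
stars-disjoint s {Fin.zero} {Fin.suc j} _ = inj₁ (m≤m+n (s Fin.zero) _)
stars-disjoint s {Fin.suc i} {Fin.zero} _ = inj₂ (m≤m+n (s Fin.zero) _)
stars-disjoint s {Fin.suc i} {Fin.suc j} i≢j with stars-disjoint (s ∘ Fin.suc) (i≢j ∘ cong Fin.suc)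
... | inj₁ le = inj₁ (≤-trans (≤-reflexive (+-assoc (s Fin.zero) _ _)) (+-monoʳ-≤ (s Fin.zero) le))
... | inj₂ le = inj₂ (≤-trans (≤-reflexive (+-assoc (s Fin.zero) _ _)) (+-monoʳ-≤ (s Fin.zero) le))

two-stars≤edges : ∀ {k} (s : Fin k → ℕ) {i j : Fin k} → i ≢ j → s i + s j ≤ edges k s
two-stars≤edges s {i} {j} i≢j with stars-disjoint s i≢j
... | inj₁ le = ≤-trans (+-monoˡ-≤ (s j) (≤-trans (m≤n+m (s i) (offset s i)) le)) (offset+size≤edges s j)
... | inj₂ le = ≤-trans (≤-reflexive (+-comm (s i) (s j)))
                  (≤-trans (+-monoˡ-≤ (s i) (≤-trans (m≤n+m (s j) (offset s j)) le)) (offset+size≤edges s i))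

-- Deleting a number x from ℕ: the numbers above x move down by one.
skip : ℕ → ℕ → ℕ
skip x y with y <? x
... | yes _ = y
... | no _ = pred y

skip-below : ∀ {x y} → y < x → skip x y ≡ y
skip-below {x} {y} y<x with y <? x
... | yes _ = refl
... | no y≮x = ⊥-elim (y≮x y<x)

skip-above : ∀ {x y} → x < y → suc (skip x y) ≡ y
skip-above {x} {suc y} x<y with suc y <? x
... | yes y<x = ⊥-elim (<-asym x<y y<x)
... | no _ = refl

skip-< : ∀ {p x y} → x < suc p → y < suc p → y ≢ x → skip x y < p
skip-< {p} {x} {y} x≤p y≤p y≢x with <-cmp y x
... | tri< y<x _ _ = subst (_< p) (sym (skip-below y<x)) (<-≤-trans y<x (s≤s⁻¹ x≤p))
... | tri≈ _ y≡x _ = ⊥-elim (y≢x y≡x)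
... | tri> _ _ x<y = subst (_≤ p) (sym (skip-above x<y)) (s≤s⁻¹ y≤p)

skip-injective : ∀ {x y y'} → y ≢ x → y' ≢ x → skip x y ≡ skip x y' → y ≡ y'
skip-injective {x} {y} {y'} y≢x y'≢x eq with <-cmp y x | <-cmp y' x
... | tri≈ _ y≡x _ | _ = ⊥-elim (y≢x y≡x)
... | _ | tri≈ _ y'≡x _ = ⊥-elim (y'≢x y'≡x)
... | tri< y<x _ _ | tri< y'<x _ _ = trans (sym (skip-below y<x)) (trans eq (skip-below y'<x))
... | tri> _ _ x<y | tri> _ _ x<y' = trans (sym (skip-above x<y)) (trans (cong suc eq) (skip-above x<y'))
... | tri< y<x _ _ | tri> _ _ x<y' =
  ⊥-elim (<⇒≱ y<x (s≤s⁻¹ (subst (x <_) (trans (sym (skip-above x<y')) (cong suc (trans (sym eq) (skip-below y<x)))) x<y')))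
... | tri> _ _ x<y | tri< y'<x _ _ =
  ⊥-elim (<⇒≱ y'<x (s≤s⁻¹ (subst (x <_) (trans (sym (skip-above x<y)) (cong suc (trans eq (skip-below y'<x)))) x<y)))

skip-shift : ∀ {x} b j → x < b ⊎ b + j < x → skip x (b + j) ≡ skip x b + j
skip-shift {x} b j (inj₂ b+j<x) =
  trans (skip-below b+j<x) (cong (_+ j) (sym (skip-below (≤-<-trans (m≤m+n b j) b+j<x))))
skip-shift {x} b j (inj₁ x<b) = suc-injective (begin
  suc (skip x (b + j))   ≡⟨ skip-above (<-≤-trans x<b (m≤m+n b j)) ⟩
  b + j                  ≡⟨ cong (_+ j) (sym (skip-above x<b)) ⟩
  suc (skip x b) + j ∎)
  where open ≡-Reasoning

module Rotation {p r : ℕ} (r<p : r < p) where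

  rotate : ℕ → ℕ
  rotate x with x + r <? p
  ... | yes _ = x + r
  ... | no _ = x + r ∸ p

  rotate-cases : ∀ x → (rotate x ≡ x + r × x + r < p) ⊎ (rotate x + p ≡ x + r × p ≤ x + r)
  rotate-cases x with x + r <? p
  ... | yes x+r<p = inj₁ (refl , x+r<p)
  ... | no x+r≮p = inj₂ (m∸n+n≡m (≮⇒≥ x+r≮p) , ≮⇒≥ x+r≮p)

  rotate-< : ∀ {x} → x < p → rotate x < p
  rotate-< {x} x<p with rotate-cases x
  ... | inj₁ (eq , x+r<p) = subst (_< p) (sym eq) x+r<p
  ... | inj₂ (eq , _) = +-cancelʳ-< p (rotate x) p (subst (_< p + p) (sym eq) (+-mono-< x<p r<p))

  no-mixed-wrap : ∀ {y y'} → y' < p → rotate y ≡ y + r → rotate y' + p ≡ y' + r → rotate y ≢ rotate y'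
  no-mixed-wrap {y} {y'} y'<p e e' eq = <⇒≱ (subst (_< p + r) (sym sum≡) (+-monoˡ-< r y'<p))
    (subst (_≤ y + r + p) (+-comm r p) (+-monoˡ-≤ p (m≤n+m r y)))
    where
    sum≡ : y + r + p ≡ y' + r
    sum≡ = trans (cong (_+ p) (trans (sym e) eq)) e'

  rotate-injective : ∀ {x x'} → x < p → x' < p → rotate x ≡ rotate x' → x ≡ x'
  rotate-injective {x} {x'} x<p x'<p eq with rotate-cases x | rotate-cases x'
  ... | inj₁ (e , _) | inj₁ (e' , _) = +-cancelʳ-≡ r x x' (trans (sym e) (trans eq e'))
  ... | inj₂ (e , _) | inj₂ (e' , _) = +-cancelʳ-≡ r x x' (trans (sym e) (trans (cong (_+ p) eq) e'))
  ... | inj₁ (e , _) | inj₂ (e' , _) = ⊥-elim (no-mixed-wrap x'<p e e' eq)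
  ... | inj₂ (e , _) | inj₁ (e' , _) = ⊥-elim (no-mixed-wrap x<p e' e (sym eq))

  rotate-step : ∀ x j → x + j < p → rotate (x + j) ≡ rotate x + j ⊎ rotate (x + j) + p ≡ rotate x + j
  rotate-step x j x+j<p with rotate-cases x | rotate-cases (x + j)
  ... | inj₁ (e , _) | inj₁ (e' , _) = inj₁ (trans e' (trans (xy∙z≈xz∙y x j r) (cong (_+ j) (sym e))))
  ... | inj₁ (e , _) | inj₂ (e' , _) = inj₂ (trans e' (trans (xy∙z≈xz∙y x j r) (cong (_+ j) (sym e))))
  ... | inj₂ (e , _) | inj₂ (e' , _) = inj₁ (+-cancelʳ-≡ p _ _ (begin
    rotate (x + j) + p  ≡⟨ e' ⟩
    x + j + r           ≡⟨ xy∙z≈xz∙y x j r ⟩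
    x + r + j           ≡⟨ cong (_+ j) (sym e) ⟩
    rotate x + p + j    ≡⟨ xy∙z≈xz∙y (rotate x) p j ⟩
    rotate x + j + p ∎))
    where open ≡-Reasoning
  ... | inj₂ (_ , p≤x+r) | inj₁ (_ , x+j+r<p) =
    ⊥-elim (<⇒≱ x+j+r<p (≤-trans p≤x+r (subst (x + r ≤_) (xy∙z≈xz∙y x r j) (m≤m+n (x + r) j))))

rotation-to : ∀ {p x y} → x < p → y < p → Σ ℕ λ r → Σ (r < p) λ r<p → Rotation.rotate r<p x ≡ y
rotation-to {p} {x} {y} x<p y<p with x ≤? y
... | yes x≤y = y ∸ x , r<p , reach
  where
  r<p : y ∸ x < p
  r<p = ≤-<-trans (m∸n≤m y x) y<p
  x+r≡y : x + (y ∸ x) ≡ y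
  x+r≡y = m+[n∸m]≡n x≤y
  reach : Rotation.rotate r<p x ≡ y
  reach with Rotation.rotate-cases r<p x
  ... | inj₁ (e , _) = trans e x+r≡y
  ... | inj₂ (_ , p≤x+r) = ⊥-elim (<⇒≱ y<p (subst (p ≤_) x+r≡y p≤x+r))
... | no x≰y = y + p ∸ x , r<p , reach
  where
  x≤y+p : x ≤ y + p
  x≤y+p = ≤-trans (<⇒≤ x<p) (m≤n+m p y)
  x+r≡y+p : x + (y + p ∸ x) ≡ y + p
  x+r≡y+p = m+[n∸m]≡n x≤y+p
  r<p : y + p ∸ x < p
  r<p = +-cancelˡ-< x _ _ (subst (_< x + p) (sym x+r≡y+p) (+-monoˡ-< p (≰⇒> x≰y)))
  reach : Rotation.rotate r<p x ≡ y
  reach with Rotation.rotate-cases r<p x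
  ... | inj₁ (_ , x+r<p) = ⊥-elim (<⇒≱ x+r<p (subst (p ≤_) (sym x+r≡y+p) (m≤n+m p y)))
  ... | inj₂ (e , _) = +-cancelʳ-≡ p _ _ (trans e x+r≡y+p)

-- The cyclic colouring of the clique on [0 , p), for 1 ≤ q with 2q < p.  An edge between x and x + j
-- (indices mod p, 1 ≤ j ≤ q) gets colour p if j = 1 and the colour x + j (its "later" end) otherwise.
-- Since 2q < p the cyclic distance j of an edge is determined by its ends, so this is well defined.
module CyclicColouring (p q : ℕ) (2q<p : q + q < p) (1≤q : 1 ≤ q) where

  -- The colour of the edge {y , z}, y ≤ z, from the difference δ = z - y.
  byDistance : ℕ → ℕ → ℕ → ℕ
  byDistance y z δ with δ ≟ 1 | suc δ ≟ p | δ ≤? q | p ≤? q + δ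
  ... | yes _ | _ | _ | _ = p
  ... | no _ | yes _ | _ | _ = p
  ... | no _ | no _ | yes _ | _ = z
  ... | no _ | no _ | no _ | yes _ = y
  ... | no _ | no _ | no _ | no _ = p

  cyclicColour : ℕ → ℕ → ℕ
  cyclicColour y z = byDistance y z (z ∸ y)

  byDistance-adjacent : ∀ y z δ → δ ≡ 1 ⊎ suc δ ≡ p → byDistance y z δ ≡ p
  byDistance-adjacent y z δ h with δ ≟ 1 | suc δ ≟ p | h
  ... | yes _ | _ | _ = refl
  ... | no _ | yes _ | _ = refl
  ... | no δ≢1 | no _ | inj₁ δ≡1 = ⊥-elim (δ≢1 δ≡1)
  ... | no _ | no δ+1≢p | inj₂ δ+1≡p = ⊥-elim (δ+1≢p δ+1≡p)

  byDistance-forward : ∀ y z δ → δ ≢ 1 → suc δ ≢ p → δ ≤ q → byDistance y z δ ≡ z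
  byDistance-forward y z δ δ≢1 δ+1≢p δ≤q with δ ≟ 1 | suc δ ≟ p | δ ≤? q
  ... | yes δ≡1 | _ | _ = ⊥-elim (δ≢1 δ≡1)
  ... | no _ | yes δ+1≡p | _ = ⊥-elim (δ+1≢p δ+1≡p)
  ... | no _ | no _ | yes _ = refl
  ... | no _ | no _ | no δ≰q = ⊥-elim (δ≰q δ≤q)

  byDistance-backward : ∀ y z δ → δ ≢ 1 → suc δ ≢ p → ¬ δ ≤ q → p ≤ q + δ → byDistance y z δ ≡ y
  byDistance-backward y z δ δ≢1 δ+1≢p δ≰q p≤q+δ with δ ≟ 1 | suc δ ≟ p | δ ≤? q | p ≤? q + δ
  ... | yes δ≡1 | _ | _ | _ = ⊥-elim (δ≢1 δ≡1)
  ... | no _ | yes δ+1≡p | _ | _ = ⊥-elim (δ+1≢p δ+1≡p)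
  ... | no _ | no _ | yes δ≤q | _ = ⊥-elim (δ≰q δ≤q)
  ... | no _ | no _ | no _ | yes _ = refl
  ... | no _ | no _ | no _ | no p≰q+δ = ⊥-elim (p≰q+δ p≤q+δ)

  q+2≤p : suc (suc q) ≤ p
  q+2≤p = ≤-trans (s≤s (subst (_≤ q + q) (+-comm q 1) (+-monoʳ-≤ q 1≤q))) 2q<p

  cyclicColour-ahead : ∀ A B j → 1 ≤ j → j ≤ q → (B ≡ A + j ⊎ B + p ≡ A + j) →
                       (j ≡ 1 → cyclicColour (A ⊓ B) (A ⊔ B) ≡ p) × (j ≢ 1 → cyclicColour (A ⊓ B) (A ⊔ B) ≡ B)
  cyclicColour-ahead A B j 1≤j j≤q (inj₁ B≡A+j) = adjacent , forward
    where
    A≤B : A ≤ B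
    A≤B = subst (A ≤_) (sym B≡A+j) (m≤m+n A j)
    δ≡j : B ∸ A ≡ j
    δ≡j = trans (cong (_∸ A) B≡A+j) (m+n∸m≡n A j)
    adjacent : j ≡ 1 → cyclicColour (A ⊓ B) (A ⊔ B) ≡ p
    adjacent j≡1 rewrite m≤n⇒m⊓n≡m A≤B | m≤n⇒m⊔n≡n A≤B = byDistance-adjacent A B (B ∸ A) (inj₁ (trans δ≡j j≡1))
    δ+1≢p : suc (B ∸ A) ≢ p
    δ+1≢p e = <-irrefl refl (≤-trans q+2≤p (subst (_≤ suc q) (trans (cong suc (sym δ≡j)) e) (s≤s j≤q)))
    forward : j ≢ 1 → cyclicColour (A ⊓ B) (A ⊔ B) ≡ B
    forward j≢1 rewrite m≤n⇒m⊓n≡m A≤B | m≤n⇒m⊔n≡n A≤B =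
      byDistance-forward A B (B ∸ A) (λ e → j≢1 (trans (sym δ≡j) e)) δ+1≢p (subst (_≤ q) (sym δ≡j) j≤q)
  cyclicColour-ahead A B j 1≤j j≤q (inj₂ B+p≡A+j) = adjacent , backward
    where
    j<p : j < p
    j<p = ≤-trans (s≤s (≤-trans j≤q (n≤1+n q))) q+2≤p
    B<A : B < A
    B<A = +-cancelʳ-< p B A (subst (_< A + p) (sym B+p≡A+j) (+-monoʳ-< A j<p))
    δ : ℕ
    δ = A ∸ B
    p≡δ+j : p ≡ δ + j
    p≡δ+j = +-cancelˡ-≡ B _ _ (begin
      B + p         ≡⟨ B+p≡A+j ⟩
      A + j         ≡⟨ cong (_+ j) (sym (m+[n∸m]≡n (<⇒≤ B<A))) ⟩
      B + δ + j     ≡⟨ +-assoc B δ j ⟩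
      B + (δ + j) ∎)
      where open ≡-Reasoning
    adjacent : j ≡ 1 → cyclicColour (A ⊓ B) (A ⊔ B) ≡ p
    adjacent j≡1 rewrite m≥n⇒m⊓n≡n (<⇒≤ B<A) | m≥n⇒m⊔n≡m (<⇒≤ B<A) =
      byDistance-adjacent B A δ (inj₂ (sym (trans p≡δ+j (trans (cong (δ +_) j≡1) (+-comm δ 1)))))
    backward : j ≢ 1 → cyclicColour (A ⊓ B) (A ⊔ B) ≡ B
    backward j≢1 rewrite m≥n⇒m⊓n≡n (<⇒≤ B<A) | m≥n⇒m⊔n≡m (<⇒≤ B<A) = byDistance-backward B A δ δ≢1 δ+1≢p δ≰q p≤q+δ
      where
      δ≢1 : δ ≢ 1
      δ≢1 e = <-irrefl refl (≤-trans q+2≤p (subst (_≤ suc q) (sym (trans p≡δ+j (cong (_+ j) e))) (s≤s j≤q)))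
      δ+1≢p : suc δ ≢ p
      δ+1≢p e = j≢1 (+-cancelˡ-≡ δ j 1 (trans (sym p≡δ+j) (trans (sym e) (+-comm 1 δ))))
      δ≰q : ¬ δ ≤ q
      δ≰q δ≤q = <-irrefl refl (≤-trans 2q<p (subst (_≤ q + q) (sym p≡δ+j) (+-mono-≤ δ≤q j≤q)))
      p≤q+δ : p ≤ q + δ
      p≤q+δ = subst (_≤ q + δ) (sym p≡δ+j) (subst (δ + j ≤_) (+-comm δ q) (+-monoʳ-≤ δ j≤q))

module _ {n t} (G : ColGraph n t) (u v : Fin n) (u≢v : u ≢ v) (a : Fin t) where

  addEdge-new : col (addEdge G u v u≢v a) u v ≡ just a
  addEdge-new with u Fin.≟ u | v Fin.≟ v
  ... | yes _ | yes _ = refl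
  ... | no u≢u | _ = ⊥-elim (u≢u refl)
  ... | yes _ | no v≢v = ⊥-elim (v≢v refl)

  addEdge-away : ∀ x y → x ≢ u → x ≢ v → col (addEdge G u v u≢v a) x y ≡ col G x y
  addEdge-away x y x≢u x≢v with x Fin.≟ u | x Fin.≟ v
  ... | yes x≡u | _ = ⊥-elim (x≢u x≡u)
  ... | no _ | yes x≡v = ⊥-elim (x≢v x≡v)
  ... | no _ | no _ = refl

  addEdge-away' : ∀ x y → y ≢ u → y ≢ v → col (addEdge G u v u≢v a) x y ≡ col G x y
  addEdge-away' x y y≢u y≢v =
    trans (sym-col (addEdge G u v u≢v a) x y) (trans (addEdge-away y x y≢u y≢v) (sym-col G y x))
    where sym-col = ColGraph.sym

sum-mono : ∀ {A : Set} (f g : A → ℕ) (xs : List A) → (∀ x → f x ≤ g x) → sum (map f xs) ≤ sum (map g xs)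
sum-mono f g [] _ = z≤n
sum-mono f g (x ∷ xs) f≤g = +-mono-≤ (f≤g x) (sum-mono f g xs f≤g)

sum-≤ : ∀ {A : Set} (f : A → ℕ) (c : ℕ) (xs : List A) → (∀ x → f x ≤ c) → sum (map f xs) ≤ length xs * c
sum-≤ f c [] _ = z≤n
sum-≤ f c (x ∷ xs) f≤c = +-mono-≤ (f≤c x) (sum-≤ f c xs f≤c)

count-below : ∀ n d c → sum (map (λ (u : Fin n) → if toℕ u <ᵇ d then c else 0) (allFin n)) ≤ d * c
count-below zero d c = z≤n
count-below (suc n) zero c =
  ≤-reflexive (trans (cong sum (map-tabulate {n = n} Fin.suc (λ (u : Fin (suc n)) → if toℕ u <ᵇ 0 then c else 0))) (sum-zeros n))
  where
  sum-zeros : ∀ m → sum (tabulate {n = m} (λ _ → 0)) ≡ 0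
  sum-zeros zero = refl
  sum-zeros (suc m) = sum-zeros m
count-below (suc n) (suc d) c = +-monoʳ-≤ c (subst (_≤ d * c) shift (count-below n d c))
  where
  shift : sum (map (λ (u : Fin n) → if toℕ u <ᵇ d then c else 0) (allFin n))
        ≡ sum (map (λ (u : Fin (suc n)) → if toℕ u <ᵇ suc d then c else 0) (tabulate Fin.suc))
  shift = cong sum (trans (map-tabulate (λ u → u) (λ (u : Fin n) → if toℕ u <ᵇ d then c else 0))
                          (sym (map-tabulate Fin.suc (λ (u : Fin (suc n)) → if toℕ u <ᵇ suc d then c else 0))))

-- On the vertices 0 , … , n-1, the set D = {0 , … , d-1} is a clique whose edges get colour ψ
-- (smaller end) (larger end), each x ∈ D is joined to each b ∈ B = {d , … , n-1} by an edge of colour κ x b, and B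
-- is independent.  Colours are computed as numbers and read in Fin t.
module SplitGraph (n' t' d : ℕ) (κ ψ : ℕ → ℕ → ℕ) where

  n t : ℕ
  n = suc n'
  t = suc t'

  -- Opaque, so that case analyses on other comparisons never unfold it.
  opaque
    splitColour : ℕ → ℕ → Maybe ℕ
    splitColour x y with x ≟ y | x <? d | y <? d
    ... | yes _ | _ | _ = nothing
    ... | no _ | yes _ | yes _ = just (ψ (x ⊓ y) (x ⊔ y))
    ... | no _ | yes _ | no _ = just (κ x y)
    ... | no _ | no _ | yes _ = just (κ y x)
    ... | no _ | no _ | no _ = nothing

    splitColour-irreflexive : ∀ x → splitColour x x ≡ nothing
    splitColour-irreflexive x with x ≟ x
    ... | yes _ = refl
    ... | no x≢x = ⊥-elim (x≢x refl)

    splitColour-sym : ∀ x y → splitColour x y ≡ splitColour y x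
    splitColour-sym x y with x ≟ y | y ≟ x | x <? d | y <? d
    ... | yes _ | yes _ | _ | _ = refl
    ... | yes x≡y | no y≢x | _ | _ = ⊥-elim (y≢x (sym x≡y))
    ... | no x≢y | yes y≡x | _ | _ = ⊥-elim (x≢y (sym y≡x))
    ... | no _ | no _ | yes _ | yes _ = cong₂ (λ a b → just (ψ a b)) (⊓-comm x y) (⊔-comm x y)
    ... | no _ | no _ | yes _ | no _ = refl
    ... | no _ | no _ | no _ | yes _ = refl
    ... | no _ | no _ | no _ | no _ = refl

    splitColour-DD : ∀ {x y} → x ≢ y → x < d → y < d → splitColour x y ≡ just (ψ (x ⊓ y) (x ⊔ y))
    splitColour-DD {x} {y} x≢y x<d y<d with x ≟ y | x <? d | y <? d
    ... | yes x≡y | _ | _ = ⊥-elim (x≢y x≡y)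
    ... | no _ | yes _ | yes _ = refl
    ... | no _ | no x≮d | _ = ⊥-elim (x≮d x<d)
    ... | no _ | yes _ | no y≮d = ⊥-elim (y≮d y<d)

    splitColour-DB : ∀ {x y} → x < d → d ≤ y → splitColour x y ≡ just (κ x y)
    splitColour-DB {x} {y} x<d d≤y with x ≟ y | x <? d | y <? d
    ... | yes refl | _ | _ = ⊥-elim (<⇒≱ x<d d≤y)
    ... | no _ | yes _ | no _ = refl
    ... | no _ | _ | yes y<d = ⊥-elim (<⇒≱ y<d d≤y)
    ... | no _ | no x≮d | _ = ⊥-elim (x≮d x<d)

    splitColour-BB : ∀ {x y} → d ≤ x → d ≤ y → splitColour x y ≡ nothing
    splitColour-BB {x} {y} d≤x d≤y with x ≟ y | x <? d | y <? d
    ... | yes _ | _ | _ = refl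
    ... | no _ | no _ | no _ = refl
    ... | no _ | yes x<d | _ = ⊥-elim (<⇒≱ x<d d≤x)
    ... | no _ | no _ | yes y<d = ⊥-elim (<⇒≱ y<d d≤y)

  splitColour-BD : ∀ {x y} → d ≤ x → y < d → splitColour x y ≡ just (κ y x)
  splitColour-BD {x} {y} d≤x y<d = trans (splitColour-sym x y) (splitColour-DB y<d d≤x)

  splitColour-edge : ∀ {x y c} → splitColour x y ≡ just c → x < d ⊎ y < d
  splitColour-edge {x} {y} eq = by-cases (x <? d) (y <? d)
    where
    by-cases : Dec (x < d) → Dec (y < d) → x < d ⊎ y < d
    by-cases (yes x<d) _ = inj₁ x<d
    by-cases (no _) (yes y<d) = inj₂ y<d
    by-cases (no x≮d) (no y≮d) with () ← trans (sym eq) (splitColour-BB (≮⇒≥ x≮d) (≮⇒≥ y≮d))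

  splitColour-nonedge : ∀ {x y} → x ≢ y → splitColour x y ≡ nothing → d ≤ x × d ≤ y
  splitColour-nonedge {x} {y} x≢y eq = by-cases (x <? d) (y <? d)
    where
    by-cases : Dec (x < d) → Dec (y < d) → d ≤ x × d ≤ y
    by-cases (yes x<d) (yes y<d) with () ← trans (sym (splitColour-DD x≢y x<d y<d)) eq
    by-cases (yes x<d) (no y≮d) with () ← trans (sym (splitColour-DB x<d (≮⇒≥ y≮d))) eq
    by-cases (no x≮d) (yes y<d) with () ← trans (sym (splitColour-BD (≮⇒≥ x≮d) y<d)) eq
    by-cases (no x≮d) (no y≮d) = ≮⇒≥ x≮d , ≮⇒≥ y≮d

  graph : ColGraph n t
  graph = record
    { col = λ x y → Data.Maybe.map clamp (splitColour (toℕ x) (toℕ y))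
    ; irrefl = λ x → cong (Data.Maybe.map clamp) (splitColour-irreflexive (toℕ x))
    ; sym = λ x y → cong (Data.Maybe.map clamp) (splitColour-sym (toℕ x) (toℕ y))
    }

  -- Every edge u v with u < v has u ∈ D, so there are at most d·n edges.
  graph-edgeCount : edgeCount graph ≤ d * n
  graph-edgeCount = begin
    edgeCount graph                                          ≤⟨ sum-mono _ _ (allFin n) row-bound ⟩
    sum (map (λ u → if toℕ u <ᵇ d then n else 0) (allFin n)) ≤⟨ count-below n d n ⟩
    d * n ∎
    where
    open ≤-Reasoning
    pair : Fin n → Fin n → ℕ
    pair u v = if (toℕ u <ᵇ toℕ v) ∧ is-just (col graph u v) then 1 else 0
    pair≤1 : ∀ u v → pair u v ≤ 1
    pair≤1 u v with (toℕ u <ᵇ toℕ v) ∧ is-just (col graph u v)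
    ... | true = ≤-refl
    ... | false = z≤n
    pair-outside-D : ∀ u → (toℕ u <ᵇ d) ≡ false → ∀ v → pair u v ≤ 0
    pair-outside-D u u∉D v with toℕ u <ᵇ toℕ v in u<v | splitColour (toℕ u) (toℕ v) in uv
    ... | false | _ = z≤n
    ... | true | nothing = z≤n
    ... | true | just _ with splitColour-edge uv
    ...   | inj₁ u<d = ⊥-elim (subst T u∉D (<⇒<ᵇ u<d))
    ...   | inj₂ v<d = ⊥-elim (subst T u∉D (<⇒<ᵇ (<-trans (<ᵇ⇒< (toℕ u) (toℕ v) (subst T (sym u<v) tt)) v<d)))
    row-bound : ∀ u → sum (map (pair u) (allFin n)) ≤ (if toℕ u <ᵇ d then n else 0)
    row-bound u with toℕ u <ᵇ d in u∈D
    ... | true = subst (sum (map (pair u) (allFin n)) ≤_) (trans (cong (_* 1) (length-tabulate {n = n} (λ v → v))) (*-identityʳ n))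
                   (sum-≤ (pair u) 1 (allFin n) (pair≤1 u))
    ... | false = subst (sum (map (pair u) (allFin n)) ≤_) (*-zeroʳ (length (allFin n)))
                   (sum-≤ (pair u) 0 (allFin n) (pair-outside-D u u∈D))

  graph-nonedge : ∀ {u v} → u ≢ v → col graph u v ≡ nothing → d ≤ toℕ u × d ≤ toℕ v
  graph-nonedge {u} {v} u≢v eq = splitColour-nonedge (u≢v ∘ FinP.toℕ-injective) (map-nothing eq)
    where
    map-nothing : ∀ {m : Maybe ℕ} → Data.Maybe.map (clamp {t'}) m ≡ nothing → m ≡ nothing
    map-nothing {nothing} _ = refl

  graph-edge : ∀ {x y c} → col graph x y ≡ just c → Σ ℕ λ w → splitColour (toℕ x) (toℕ y) ≡ just w × clamp w ≡ c
  graph-edge {x} {y} eq = from-map (splitColour (toℕ x) (toℕ y)) eq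
    where
    from-map : ∀ {c} (m : Maybe ℕ) → Data.Maybe.map clamp m ≡ just c → Σ ℕ λ w → m ≡ just w × clamp w ≡ c
    from-map (just w) refl = w , refl , refl

  record Realisation {k} (s : Fin k → ℕ) (u v : Fin n) (a : Fin t) : Set where
    field
      vertex : HVert k s → ℕ
      colour : HEdge k s → ℕ
      vertex<n : ∀ w → vertex w < n
      colour<t : ∀ e → colour e < t
      vertex-injective : ∀ w w' → vertex w ≡ vertex w' → w ≡ w'
      colour-injective : ∀ e e' → colour e ≡ colour e' → e ≡ e'
      realised : ∀ i (y : Fin (s i)) →
        (vertex (i , Fin.zero) ≡ toℕ u × vertex (i , Fin.suc y) ≡ toℕ v × colour (i , y) ≡ toℕ a)
        ⊎ splitColour (vertex (i , Fin.zero)) (vertex (i , Fin.suc y)) ≡ just (colour (i , y))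

  realisation⇒rainbow : ∀ {k s u v a} (u≢v : u ≢ v) → col graph u v ≡ nothing →
                        Realisation {k} s u v a → HasRainbowCopy k s (addEdge graph u v u≢v a)
  realisation⇒rainbow {k} {s} {u} {v} {a} u≢v uv∉G ρ =
    clamp ∘ vertex , clamp ∘ colour ,
    (λ {w} {w'} eq → vertex-injective w w' (clamp-injective (vertex<n w) (vertex<n w') eq)) ,
    (λ {e} {e'} eq → colour-injective e e' (clamp-injective (colour<t e) (colour<t e') eq)) ,
    (λ (i , y) → edge i y (realised i y))
    where
    open Realisation ρ
    G' = addEdge graph u v u≢v a
    u,v∈B = graph-nonedge u≢v uv∉G
    D-away : ∀ {x} → x < n → x < d → clamp x ≢ u × clamp x ≢ v
    D-away {x} x<n x<d = away (proj₁ u,v∈B) , away (proj₂ u,v∈B)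
      where
      away : ∀ {z} → d ≤ toℕ z → clamp x ≢ z
      away d≤z refl = <⇒≱ x<d (subst (d ≤_) (toℕ-clamp x x<n) d≤z)
    in-graph : ∀ {x y c} → x < n → y < n → splitColour x y ≡ just c →
               col graph (clamp x) (clamp y) ≡ just (clamp c)
    in-graph {x} {y} x<n y<n eq =
      cong (Data.Maybe.map clamp) (trans (cong₂ splitColour (toℕ-clamp x x<n) (toℕ-clamp y y<n)) eq)
    edge : ∀ i y → _ → col G' (clamp (vertex (i , Fin.zero))) (clamp (vertex (i , Fin.suc y))) ≡ just (clamp (colour (i , y)))
    edge i y (inj₁ (at-u , at-v , colour-a)) = begin
      col G' (clamp (vertex (i , Fin.zero))) (clamp (vertex (i , Fin.suc y))) ≡⟨ cong₂ (λ x z → col G' (clamp x) (clamp z)) at-u at-v ⟩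
      col G' (clamp (toℕ u)) (clamp (toℕ v))  ≡⟨ cong₂ (col G') (clamp-toℕ u) (clamp-toℕ v) ⟩
      col G' u v                              ≡⟨ addEdge-new graph u v u≢v a ⟩
      just a                                  ≡⟨ cong just (sym (trans (cong clamp colour-a) (clamp-toℕ a))) ⟩
      just (clamp (colour (i , y))) ∎
      where open ≡-Reasoning
    edge i y (inj₂ coloured) with splitColour-edge coloured
    ... | inj₁ centre∈D = let (≢u , ≢v) = D-away (vertex<n _) centre∈D in
      trans (addEdge-away graph u v u≢v a _ _ ≢u ≢v) (in-graph (vertex<n _) (vertex<n _) coloured)
    ... | inj₂ leaf∈D = let (≢u , ≢v) = D-away (vertex<n _) leaf∈D in
      trans (addEdge-away' graph u v u≢v a _ _ ≢u ≢v) (in-graph (vertex<n _) (vertex<n _) coloured)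

  -- Each star of a copy of H has an edge, hence a vertex in D; so a copy of k stars needs k ≤ d.
  copy⇒stars≤d : ∀ {k s} → (∀ i → 1 ≤ s i) → HasRainbowCopy k s graph → k ≤ d
  copy⇒stars≤d {k} {s} s≥1 (f , c , f-injective , _ , is-edge) = FinP.injective⇒≤ {f = toD} toD-injective
    where
    inD : ∀ i → Σ (HVert k s) λ w → toℕ (f w) < d × proj₁ w ≡ i
    inD i with splitColour-edge (proj₁ (proj₂ (graph-edge (is-edge (i , fromℕ< (s≥1 i))))))
    ... | inj₁ centre∈D = (i , Fin.zero) , centre∈D , refl
    ... | inj₂ leaf∈D = (i , Fin.suc (fromℕ< (s≥1 i))) , leaf∈D , refl
    toD : Fin k → Fin d
    toD i = fromℕ< (proj₁ (proj₂ (inD i)))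
    toD-injective : ∀ {i j} → toD i ≡ toD j → i ≡ j
    toD-injective {i} {j} eq = trans (sym (proj₂ (proj₂ (inD i))))
      (trans (cong proj₁ (f-injective (FinP.toℕ-injective (trans (sym (FinP.toℕ-fromℕ< _))
                                                          (trans (cong toℕ eq) (FinP.toℕ-fromℕ< _))))))
             (proj₂ (proj₂ (inD j))))

-- In a split graph whose edges leaving D have the colour of their end in D, a rainbow copy of H has e(H) ≤ d:
-- each edge of H is charged to a vertex of D, namely its leaf if that lies in D and otherwise its centre, and
-- different edges are charged to different vertices (two edges charged to the same centre would share a colour).
module _ {n' t' d : ℕ} {ψ : ℕ → ℕ → ℕ} where
  open SplitGraph n' t' d (λ x _ → x) ψ

  rainbow⇒edges≤d : ∀ {k s} → HasRainbowCopy k s graph → edges k s ≤ d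
  rainbow⇒edges≤d {k} {s} (f , c , f-injective , c-injective , is-edge) = edges-pigeonhole charge charge-injective
    where
    centre leaf : HEdge k s → HVert k s
    centre (i , _) = i , Fin.zero
    leaf (i , y) = i , Fin.suc y
    edge-colour : ∀ e → Σ ℕ λ w → splitColour (toℕ (f (centre e))) (toℕ (f (leaf e))) ≡ just w × clamp w ≡ c e
    edge-colour e = graph-edge (is-edge e)

    data Charged (e : HEdge k s) : Set where
      to-leaf : toℕ (f (leaf e)) < d → Charged e
      to-centre : toℕ (f (centre e)) < d → d ≤ toℕ (f (leaf e)) → Charged e

    charged : ∀ e → Charged e
    charged e with toℕ (f (leaf e)) <? d
    ... | yes leaf∈D = to-leaf leaf∈D
    ... | no leaf∉D with splitColour-edge (proj₁ (proj₂ (edge-colour e)))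
    ...   | inj₁ centre∈D = to-centre centre∈D (≮⇒≥ leaf∉D)
    ...   | inj₂ leaf∈D = ⊥-elim (leaf∉D leaf∈D)

    chargedVertex : ∀ e → Charged e → HVert k s
    chargedVertex e (to-leaf _) = leaf e
    chargedVertex e (to-centre _ _) = centre e

    chargedVertex∈D : ∀ e (ch : Charged e) → toℕ (f (chargedVertex e ch)) < d
    chargedVertex∈D e (to-leaf leaf∈D) = leaf∈D
    chargedVertex∈D e (to-centre centre∈D _) = centre∈D

    charge : HEdge k s → Fin d
    charge e = fromℕ< (chargedVertex∈D e (charged e))

    colour-centre : ∀ e → toℕ (f (centre e)) < d → d ≤ toℕ (f (leaf e)) → c e ≡ clamp (toℕ (f (centre e)))
    colour-centre e centre∈D leaf∈B with edge-colour e
    ... | w , coloured , clamp-w≡c =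
      trans (sym clamp-w≡c) (cong clamp (just-injective (trans (sym coloured) (splitColour-DB centre∈D leaf∈B))))
      where
      just-injective : ∀ {x y : ℕ} → just x ≡ just y → x ≡ y
      just-injective refl = refl

    charged-injective : ∀ e e' (ch : Charged e) (ch' : Charged e') →
                        f (chargedVertex e ch) ≡ f (chargedVertex e' ch') → e ≡ e'
    charged-injective e e' (to-leaf _) (to-leaf _) eq with f-injective eq
    ... | refl = refl
    charged-injective e e' (to-leaf _) (to-centre _ _) eq with f-injective eq
    ... | ()
    charged-injective e e' (to-centre _ _) (to-leaf _) eq with f-injective eq
    ... | ()
    charged-injective e e' (to-centre c∈D l∈B) (to-centre c'∈D l'∈B) eq =
      c-injective (trans (colour-centre e c∈D l∈B) (trans (cong (clamp ∘ toℕ) eq) (sym (colour-centre e' c'∈D l'∈B))))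

    charge-injective : ∀ {e e'} → charge e ≡ charge e' → e ≡ e'
    charge-injective {e} {e'} eq = charged-injective e e' (charged e) (charged e')
      (FinP.toℕ-injective (trans (sym (FinP.toℕ-fromℕ< _)) (trans (cong toℕ eq) (FinP.toℕ-fromℕ< _))))

-- Construction 1: some star S i₀ of H is a single edge.  Take the split graph with d = k - 1 in which the edge from
-- D to b ∈ B has colour b mod t.  A copy of H would need k vertices in D.  When a non-edge uv is added in colour a,
-- uv becomes S i₀ and every other star S i gets its centre in D and its leaves in B, the colours being the numbers
-- of the edges with those of e₀ = S i₀ and a exchanged; a leaf in B is chosen in the residue class of its colour.
module SingleEdgeStar (k' : ℕ) (s : Fin (suc k') → ℕ) (s≥1 : ∀ i → 1 ≤ s i) (i₀ : Fin (suc k')) (s-i₀≡1 : s i₀ ≡ 1)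
                      (t' : ℕ) (e≤t : edges (suc k') s ≤ suc t') (n' : ℕ) (n-large : (k' + 3) * suc t' ≤ suc n') where

  k : ℕ
  k = suc k'

  open SplitGraph n' t' k' (λ _ b → b % suc t') (λ _ _ → 0) public

  no-rainbow : ¬ HasRainbowCopy k s graph
  no-rainbow copy = 1+n≰n (copy⇒stars≤d s≥1 copy)

  the-leaf : Fin (s i₀)
  the-leaf = fromℕ< (s≥1 i₀)

  the-leaf-unique : ∀ (y : Fin (s i₀)) → y ≡ the-leaf
  the-leaf-unique y = Fin1-unique s-i₀≡1 y the-leaf
    where
    Fin1-unique : ∀ {m} → m ≡ 1 → (y y' : Fin m) → y ≡ y'
    Fin1-unique refl Fin.zero Fin.zero = refl

  e₀ : HEdge k s
  e₀ = i₀ , the-leaf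

  module Embedding (u v : Fin n) (u≢v : u ≢ v) (uv∉G : col graph u v ≡ nothing) (a : Fin t) where

    u,v∈B : k' ≤ toℕ u × k' ≤ toℕ v
    u,v∈B = graph-nonedge u≢v uv∉G

    -- Colours: the numbers of the edges, with the numbers of e₀ and of a exchanged, so that e₀ gets colour a.
    number : HEdge k s → Fin t
    number e = Fin.inject≤ (edgeIndex e) e≤t

    colourOf : HEdge k s → Fin t
    colourOf e = transpose (number e₀) a (number e)

    colourOf-e₀ : colourOf e₀ ≡ a
    colourOf-e₀ with number e₀ Fin.≟ number e₀
    ... | yes _ = refl
    ... | no ≢ = ⊥-elim (≢ refl)

    colourOf-injective : ∀ e e' → colourOf e ≡ colourOf e' → e ≡ e'
    colourOf-injective e e' eq = edgeIndex-injective (FinP.inject≤-injective e≤t e≤t _ _ (begin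
      number e                                                  ≡⟨ sym (transpose-inverse a (number e₀)) ⟩
      transpose a (number e₀) (colourOf e)                      ≡⟨ cong (transpose a (number e₀)) eq ⟩
      transpose a (number e₀) (colourOf e')                     ≡⟨ transpose-inverse a (number e₀) ⟩
      number e' ∎))
      where open ≡-Reasoning

    colour : HEdge k s → ℕ
    colour e = toℕ (colourOf e)

    -- The leaf of e ≠ e₀ goes to a vertex of B in the residue class of colour e, avoiding u and v.
    candidate : HEdge k s → ℕ → ℕ
    candidate e m = colour e + (k' + m) * t

    candidate-injective : ∀ e m m' → candidate e m ≡ candidate e m' → m ≡ m'
    candidate-injective e m m' eq = +-cancelˡ-≡ k' m m' (*-cancelʳ-≡ (k' + m) (k' + m') t (+-cancelˡ-≡ (colour e) _ _ eq))

    leafChoice : ∀ e → Σ ℕ λ m → m < 3 × candidate e m ≢ toℕ u × candidate e m ≢ toℕ v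
    leafChoice e = avoid-two (candidate e) (candidate-injective e) (toℕ u) (toℕ v)

    leafAt : HEdge k s → ℕ
    leafAt e = candidate e (proj₁ (leafChoice e))

    leafAt-colour : ∀ e → leafAt e % t ≡ colour e
    leafAt-colour e = trans ([m+kn]%n≡m%n (colour e) (k' + proj₁ (leafChoice e)) t) (m<n⇒m%n≡m (FinP.toℕ<n (colourOf e)))

    leafAt-injective : ∀ {e e'} → leafAt e ≡ leafAt e' → e ≡ e'
    leafAt-injective {e} {e'} eq = colourOf-injective e e' (FinP.toℕ-injective
      (proj₁ (divmod-unique (colour e) (k' + proj₁ (leafChoice e)) (colour e') (k' + proj₁ (leafChoice e'))
                            (FinP.toℕ<n (colourOf e)) (FinP.toℕ<n (colourOf e')) eq)))

    leafAt∈B : ∀ e → k' ≤ leafAt e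
    leafAt∈B e = ≤-trans (m≤m+n k' _) (≤-trans (m≤m*n (k' + _) t) (m≤n+m _ (colour e)))

    leafAt<n : ∀ e → leafAt e < n
    leafAt<n e = begin-strict
      colour e + (k' + m) * t ≤⟨ +-monoʳ-≤ (colour e) (*-monoˡ-≤ t (+-monoʳ-≤ k' (s≤s⁻¹ m<3))) ⟩
      colour e + (k' + 2) * t <⟨ +-monoˡ-< ((k' + 2) * t) (FinP.toℕ<n (colourOf e)) ⟩
      t + (k' + 2) * t        ≡⟨ cong (_* t) (sym (+-suc k' 2)) ⟩
      (k' + 3) * t            ≤⟨ n-large ⟩
      n ∎
      where
      open ≤-Reasoning
      m = proj₁ (leafChoice e)
      m<3 = proj₁ (proj₂ (leafChoice e))

    centre : Fin k → ℕ
    centre i with i₀ Fin.≟ i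
    ... | yes _ = toℕ u
    ... | no i₀≢i = toℕ (Fin.punchOut i₀≢i)

    leaf : HEdge k s → ℕ
    leaf (i , y) with i₀ Fin.≟ i
    ... | yes _ = toℕ v
    ... | no _ = leafAt (i , y)

    vertex : HVert k s → ℕ
    vertex (i , Fin.zero) = centre i
    vertex (i , Fin.suc y) = leaf (i , y)

    centre-i₀ : centre i₀ ≡ toℕ u
    centre-i₀ with i₀ Fin.≟ i₀
    ... | yes _ = refl
    ... | no i₀≢i₀ = ⊥-elim (i₀≢i₀ refl)

    centre-other : ∀ {i} (i₀≢i : i₀ ≢ i) → centre i ≡ toℕ (Fin.punchOut i₀≢i)
    centre-other {i} i₀≢i with i₀ Fin.≟ i
    ... | yes i₀≡i = ⊥-elim (i₀≢i i₀≡i)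
    ... | no _ = cong toℕ (FinP.punchOut-cong i₀ refl)

    leaf-i₀ : ∀ y → leaf (i₀ , y) ≡ toℕ v
    leaf-i₀ y with i₀ Fin.≟ i₀
    ... | yes _ = refl
    ... | no i₀≢i₀ = ⊥-elim (i₀≢i₀ refl)

    leaf-other : ∀ {i} y → i₀ ≢ i → leaf (i , y) ≡ leafAt (i , y)
    leaf-other {i} y i₀≢i with i₀ Fin.≟ i
    ... | yes i₀≡i = ⊥-elim (i₀≢i i₀≡i)
    ... | no _ = refl

    data BVertex : Set where
      at-u at-v : BVertex
      leaf-of : HEdge k s → BVertex

    occupant : BVertex → HVert k s
    occupant at-u = i₀ , Fin.zero
    occupant at-v = i₀ , Fin.suc the-leaf
    occupant (leaf-of (i , y)) = i , Fin.suc y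

    labelB : BVertex → ℕ
    labelB at-u = toℕ u
    labelB at-v = toℕ v
    labelB (leaf-of e) = leafAt e

    open Sources (λ (_ : Fin k') → ⊤) (λ j → Fin.punchIn i₀ j , Fin.zero) occupant toℕ labelB vertex

    source : ∀ w → Source w
    source (i , Fin.zero) with i₀ Fin.≟ i
    ... | yes refl = viaB at-u refl centre-i₀
    ... | no i₀≢i = viaD (Fin.punchOut i₀≢i) tt (cong (_, Fin.zero) (sym (FinP.punchIn-punchOut i₀≢i))) (centre-other i₀≢i)
    source (i , Fin.suc y) with i₀ Fin.≟ i
    ... | yes refl = viaB at-v (cong (λ z → i₀ , Fin.suc z) (the-leaf-unique y)) (leaf-i₀ y)
    ... | no i₀≢i = viaB (leaf-of (i , y)) refl (leaf-other y i₀≢i)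

    labelB-injective : ∀ {b b'} → labelB b ≡ labelB b' → b ≡ b'
    labelB-injective {at-u} {at-u} _ = refl
    labelB-injective {at-v} {at-v} _ = refl
    labelB-injective {leaf-of e} {leaf-of e'} eq = cong leaf-of (leafAt-injective eq)
    labelB-injective {at-u} {at-v} eq = ⊥-elim (u≢v (FinP.toℕ-injective eq))
    labelB-injective {at-v} {at-u} eq = ⊥-elim (u≢v (FinP.toℕ-injective (sym eq)))
    labelB-injective {at-u} {leaf-of e} eq = ⊥-elim (proj₁ (proj₂ (proj₂ (leafChoice e))) (sym eq))
    labelB-injective {leaf-of e} {at-u} eq = ⊥-elim (proj₁ (proj₂ (proj₂ (leafChoice e))) eq)
    labelB-injective {at-v} {leaf-of e} eq = ⊥-elim (proj₂ (proj₂ (proj₂ (leafChoice e))) (sym eq))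
    labelB-injective {leaf-of e} {at-v} eq = ⊥-elim (proj₂ (proj₂ (proj₂ (leafChoice e))) eq)

    labelB∈B : ∀ b → k' ≤ labelB b
    labelB∈B at-u = proj₁ u,v∈B
    labelB∈B at-v = proj₂ u,v∈B
    labelB∈B (leaf-of e) = leafAt∈B e

    vertex<n : ∀ w → vertex w < n
    vertex<n w with source w
    ... | viaD j _ _ eq = subst (_< n) (sym eq) (<-≤-trans (FinP.toℕ<n j) (≤-trans (m≤m+n k' 3) (≤-trans (m≤m*n (k' + 3) t) n-large)))
    ... | viaB at-u _ eq = subst (_< n) (sym eq) (FinP.toℕ<n u)
    ... | viaB at-v _ eq = subst (_< n) (sym eq) (FinP.toℕ<n v)
    ... | viaB (leaf-of e) _ eq = subst (_< n) (sym eq) (leafAt<n e)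

    realisation : Realisation s u v a
    realisation = record
      { vertex = vertex
      ; colour = colour
      ; vertex<n = vertex<n
      ; colour<t = λ e → FinP.toℕ<n (colourOf e)
      ; vertex-injective = sourced-injective k' (λ {j} _ → FinP.toℕ<n j) labelB∈B
                             (λ _ _ eq → FinP.toℕ-injective eq) labelB-injective source
      ; colour-injective = λ e e' eq → colourOf-injective e e' (FinP.toℕ-injective eq)
      ; realised = realised
      }
      where
      realised : ∀ i (y : Fin (s i)) →
        (vertex (i , Fin.zero) ≡ toℕ u × vertex (i , Fin.suc y) ≡ toℕ v × colour (i , y) ≡ toℕ a)
        ⊎ splitColour (vertex (i , Fin.zero)) (vertex (i , Fin.suc y)) ≡ just (colour (i , y))
      realised i y with i₀ Fin.≟ i
      ... | yes refl =
        inj₁ (refl , refl , cong toℕ (trans (cong (λ z → colourOf (i₀ , z)) (the-leaf-unique y)) colourOf-e₀))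
      ... | no i₀≢i = inj₂ (begin
        splitColour (toℕ (Fin.punchOut i₀≢i)) (leafAt (i , y)) ≡⟨ splitColour-DB (FinP.toℕ<n (Fin.punchOut i₀≢i)) (leafAt∈B (i , y)) ⟩
        just (leafAt (i , y) % t)                             ≡⟨ cong just (leafAt-colour (i , y)) ⟩
        just (colour (i , y)) ∎)
        where open ≡-Reasoning

  saturated : RainbowSaturated k s graph
  saturated = no-rainbow , λ u v u≢v uv∉G a → realisation⇒rainbow u≢v uv∉G (Embedding.realisation u v u≢v uv∉G a)

-- Construction 2: every star has at least two leaves.  Let p = e(H) - 1 and let i₀ ≢ i₁ be stars with s i₁ ≤ s i₀,
-- q = s i₁ - 1 (so 1 ≤ q and 2q < p).  Take the split graph with d = p in which an edge leaving D has the colour of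
-- its end in D, and D carries the cyclic colouring.  A rainbow H would need e(H) ≤ p.  When a non-edge uv is added
-- in colour a, the edge e₀ (first leaf of S i₀) goes to uv, every other edge e gets the slot "position of e" of D,
-- rotated so that, if a < p, the second edge eX of S i₁ lands on the vertex a.  The other leaves sit in their slots
-- (colour = slot) and the other centres on "hubs" in B.  If a < p the star S i₁ is moved: its centre takes the slot
-- of its first edge eS, whose leaf goes to a hub, and its edges inside D get the cyclic colours, eX getting colour p.
module LargeStars (k' : ℕ) (s : Fin (suc k') → ℕ) (s≥2 : ∀ i → 2 ≤ s i) (i₀ i₁ : Fin (suc k')) (i₀≢i₁ : i₀ ≢ i₁)
                  (s-i₁≤s-i₀ : s i₁ ≤ s i₀) (t' p : ℕ) (edges≡ : edges (suc k') s ≡ suc p) (p<t : p < suc t')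
                  (n' : ℕ) (n-large : p + 3 * suc k' ≤ suc n') where

  k q : ℕ
  k = suc k'
  q = pred (s i₁)

  s-i₁≡q+1 : s i₁ ≡ suc q
  s-i₁≡q+1 with s i₁ | s≥2 i₁
  ... | suc _ | _ = refl

  1≤q : 1 ≤ q
  1≤q = s≤s⁻¹ (subst (2 ≤_) s-i₁≡q+1 (s≥2 i₁))

  2q<p : q + q < p
  2q<p = s≤s⁻¹ (begin
    suc (suc (q + q)) ≡⟨ cong suc (sym (+-suc q q)) ⟩
    suc q + suc q     ≡⟨ cong₂ _+_ (sym s-i₁≡q+1) (sym s-i₁≡q+1) ⟩
    s i₁ + s i₁       ≤⟨ +-monoʳ-≤ (s i₁) s-i₁≤s-i₀ ⟩
    s i₁ + s i₀       ≡⟨ +-comm (s i₁) (s i₀) ⟩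
    s i₀ + s i₁       ≤⟨ two-stars≤edges s i₀≢i₁ ⟩
    edges k s         ≡⟨ edges≡ ⟩
    suc p ∎)
    where open ≤-Reasoning

  open CyclicColouring p q 2q<p 1≤q
  open SplitGraph n' t' p (λ x _ → x) cyclicColour public

  no-rainbow : ¬ HasRainbowCopy k s graph
  no-rainbow copy = 1+n≰n (subst (_≤ p) edges≡ (rainbow⇒edges≤d copy))

  e₀ eS eX : HEdge k s
  e₀ = i₀ , fromℕ< (≤-trans (s≤s z≤n) (s≥2 i₀))
  eS = i₁ , fromℕ< (≤-trans (s≤s z≤n) (s≥2 i₁))
  eX = i₁ , fromℕ< (s≥2 i₁)

  position : HEdge k s → ℕ
  position e = skip (toℕ (edgeIndex e₀)) (toℕ (edgeIndex e))

  index≢ : ∀ {e} → e ≢ e₀ → toℕ (edgeIndex e) ≢ toℕ (edgeIndex e₀)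
  index≢ e≢e₀ eq = e≢e₀ (edgeIndex-injective (FinP.toℕ-injective eq))

  position<p : ∀ {e} → e ≢ e₀ → position e < p
  position<p {e} e≢e₀ = skip-< (index<p+1 e₀) (index<p+1 e) (index≢ e≢e₀)
    where
    index<p+1 : ∀ e → toℕ (edgeIndex e) < suc p
    index<p+1 e = subst (toℕ (edgeIndex e) <_) edges≡ (FinP.toℕ<n (edgeIndex e))

  position-injective : ∀ {e e'} → e ≢ e₀ → e' ≢ e₀ → position e ≡ position e' → e ≡ e'
  position-injective e≢e₀ e'≢e₀ eq =
    edgeIndex-injective (FinP.toℕ-injective (skip-injective (index≢ e≢e₀) (index≢ e'≢e₀) eq))

  P : ℕ
  P = position eS

  position-i₁ : ∀ y → position (i₁ , y) ≡ P + toℕ y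
  position-i₁ y = begin
    skip x (toℕ (edgeIndex (i₁ , y)))  ≡⟨ cong (skip x) (toℕ-edgeIndex i₁ y) ⟩
    skip x (offset s i₁ + toℕ y)       ≡⟨ skip-shift (offset s i₁) (toℕ y) avoids ⟩
    skip x (offset s i₁) + toℕ y       ≡⟨ cong (λ z → skip x z + toℕ y) (sym first-index) ⟩
    P + toℕ y ∎
    where
    open ≡-Reasoning
    x = toℕ (edgeIndex e₀)
    first-index : toℕ (edgeIndex eS) ≡ offset s i₁
    first-index = trans (toℕ-edgeIndex i₁ _) (trans (cong (offset s i₁ +_) (FinP.toℕ-fromℕ< _)) (+-identityʳ _))
    x≡ : x ≡ offset s i₀
    x≡ = trans (toℕ-edgeIndex i₀ _) (trans (cong (offset s i₀ +_) (FinP.toℕ-fromℕ< _)) (+-identityʳ _))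
    avoids : x < offset s i₁ ⊎ offset s i₁ + toℕ y < x
    avoids with stars-disjoint s i₀≢i₁
    ... | inj₁ before = inj₁ (subst (_< offset s i₁) (sym x≡) (<-≤-trans (m<m+n _ (≤-trans (s≤s z≤n) (s≥2 i₀))) before))
    ... | inj₂ after = inj₂ (subst (offset s i₁ + toℕ y <_) (sym x≡)
                              (<-≤-trans (+-monoʳ-< (offset s i₁) (FinP.toℕ<n y)) after))

  i₁-edge≢e₀ : ∀ y → (i₁ , y) ≢ e₀
  i₁-edge≢e₀ y eq = i₀≢i₁ (sym (cong proj₁ eq))

  position-eX : position eX ≡ P + 1
  position-eX = trans (position-i₁ _) (cong (P +_) (FinP.toℕ-fromℕ< _))

  eX≢eS : eX ≢ eS
  eX≢eS eq = 1+n≢0 (+-cancelˡ-≡ P 1 0 (trans (sym position-eX) (trans (cong position eq) (sym (+-identityʳ P)))))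

  -- The embedding of H into G + uv (colour a), with slots rotated by r; if swapped, S i₁ is moved and the
  -- rotation puts eX on the vertex a, otherwise a ≥ p is not a slot colour.
  module Embedding (u v : Fin n) (u≢v : u ≢ v) (uv∉G : col graph u v ≡ nothing) (a : Fin t)
                   (swapped : Bool) {r : ℕ} (r<p : r < p)
                   (swap-hits : swapped ≡ true → Rotation.rotate r<p (P + 1) ≡ toℕ a)
                   (plain-above : swapped ≡ false → p ≤ toℕ a) where

    open Rotation r<p

    u,v∈B : p ≤ toℕ u × p ≤ toℕ v
    u,v∈B = graph-nonedge u≢v uv∉G

    candidate : Fin k → ℕ → ℕ
    candidate i m = p + (m + toℕ i * 3)

    hubChoice : ∀ i → Σ ℕ λ m → m < 3 × candidate i m ≢ toℕ u × candidate i m ≢ toℕ v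
    hubChoice i = avoid-two (candidate i) (λ m m' eq → +-cancelʳ-≡ _ m m' (+-cancelˡ-≡ p _ _ eq)) (toℕ u) (toℕ v)

    hub : Fin k → ℕ
    hub i = candidate i (proj₁ (hubChoice i))

    hub∈B : ∀ i → p ≤ hub i
    hub∈B i = m≤m+n p _

    hub<n : ∀ i → hub i < n
    hub<n i = begin-strict
      p + (m + toℕ i * 3) <⟨ +-monoʳ-< p (+-mono-<-≤ m<3 (*-monoˡ-≤ 3 (s≤s⁻¹ (FinP.toℕ<n i)))) ⟩
      p + k * 3           ≡⟨ cong (p +_) (*-comm k 3) ⟩
      p + 3 * k           ≤⟨ n-large ⟩
      n ∎
      where
      open ≤-Reasoning
      m = proj₁ (hubChoice i)
      m<3 = proj₁ (proj₂ (hubChoice i))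

    hub-injective : ∀ {i i'} → hub i ≡ hub i' → i ≡ i'
    hub-injective {i} {i'} eq = FinP.toℕ-injective (proj₂ (divmod-unique {3} _ (toℕ i) _ (toℕ i')
      (proj₁ (proj₂ (hubChoice i))) (proj₁ (proj₂ (hubChoice i'))) (+-cancelˡ-≡ p _ _ eq)))

    Moved : Fin k → Set
    Moved i = swapped ≡ true × i ≡ i₁

    data CentreRole (i : Fin k) : Set where
      centre-u : i ≡ i₀ → CentreRole i
      centre-slot : Moved i → CentreRole i
      centre-hub : i ≢ i₀ → ¬ Moved i → CentreRole i

    data LeafRole (e : HEdge k s) : Set where
      leaf-v : e ≡ e₀ → LeafRole e
      leaf-hub : swapped ≡ true → e ≡ eS → LeafRole e
      leaf-slot : e ≢ e₀ → ¬ (swapped ≡ true × e ≡ eS) → LeafRole e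

    data ColourRole (e : HEdge k s) : Set where
      colour-a : e ≡ e₀ → ColourRole e
      colour-p : swapped ≡ true → e ≡ eX → ColourRole e
      colour-slot : e ≢ e₀ → ¬ (swapped ≡ true × e ≡ eX) → ColourRole e

    _≟E_ : (e e' : HEdge k s) → Dec (e ≡ e')
    _≟E_ = ≡-dec Fin._≟_ Fin._≟_

    swapped? : Dec (swapped ≡ true)
    swapped? = swapped Data.Bool.≟ true

    centreRole : ∀ i → CentreRole i
    centreRole i with i Fin.≟ i₀ | swapped? ×-dec (i Fin.≟ i₁)
    ... | yes i≡i₀ | _ = centre-u i≡i₀
    ... | no _ | yes moved = centre-slot moved
    ... | no i≢i₀ | no unmoved = centre-hub i≢i₀ unmoved

    leafRole : ∀ e → LeafRole e
    leafRole e with e ≟E e₀ | swapped? ×-dec (e ≟E eS)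
    ... | yes e≡e₀ | _ = leaf-v e≡e₀
    ... | no _ | yes (sw , e≡eS) = leaf-hub sw e≡eS
    ... | no e≢e₀ | no unmoved = leaf-slot e≢e₀ unmoved

    colourRole : ∀ e → ColourRole e
    colourRole e with e ≟E e₀ | swapped? ×-dec (e ≟E eX)
    ... | yes e≡e₀ | _ = colour-a e≡e₀
    ... | no _ | yes (sw , e≡eX) = colour-p sw e≡eX
    ... | no e≢e₀ | no other = colour-slot e≢e₀ other

    slot : HEdge k s → ℕ
    slot e = rotate (position e)

    centreAt : ∀ {i} → CentreRole i → ℕ
    centreAt (centre-u _) = toℕ u
    centreAt (centre-slot _) = slot eS
    centreAt {i} (centre-hub _ _) = hub i

    leafAt : ∀ {e} → LeafRole e → ℕ
    leafAt (leaf-v _) = toℕ v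
    leafAt (leaf-hub _ _) = hub i₁
    leafAt {e} (leaf-slot _ _) = slot e

    colourAt : ∀ {e} → ColourRole e → ℕ
    colourAt (colour-a _) = toℕ a
    colourAt (colour-p _ _) = p
    colourAt {e} (colour-slot _ _) = slot e

    vertex : HVert k s → ℕ
    vertex (i , Fin.zero) = centreAt (centreRole i)
    vertex (i , Fin.suc y) = leafAt (leafRole (i , y))

    colour : HEdge k s → ℕ
    colour e = colourAt (colourRole e)

    slot<p : ∀ {e} → e ≢ e₀ → slot e < p
    slot<p e≢e₀ = rotate-< (position<p e≢e₀)

    slot-injective : ∀ {e e'} → e ≢ e₀ → e' ≢ e₀ → slot e ≡ slot e' → e ≡ e'
    slot-injective e≢e₀ e'≢e₀ eq = position-injective e≢e₀ e'≢e₀ (rotate-injective (position<p e≢e₀) (position<p e'≢e₀) eq)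

    p<n : p < n
    p<n = <-≤-trans (m<m+n p (s≤s z≤n)) n-large

    -- Injectivity of the vertex labels: each vertex of H sits in a slot (in D) or on u, v or a hub (in B).
    data BVertex : Set where
      at-u at-v : BVertex
      at-hub : Fin k → BVertex

    labelB : BVertex → ℕ
    labelB at-u = toℕ u
    labelB at-v = toℕ v
    labelB (at-hub i) = hub i

    slotOccupant : ∀ {e} → LeafRole e → HVert k s
    slotOccupant {e} (leaf-slot _ _) = proj₁ e , Fin.suc (proj₂ e)
    slotOccupant (leaf-hub _ _) = i₁ , Fin.zero
    slotOccupant (leaf-v _) = i₀ , Fin.zero

    hubOccupant : ∀ {i} → CentreRole i → HVert k s
    hubOccupant {i} (centre-hub _ _) = i , Fin.zero
    hubOccupant (centre-slot _) = i₁ , Fin.suc (proj₂ eS)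
    hubOccupant (centre-u _) = i₀ , Fin.zero

    occupant : BVertex → HVert k s
    occupant at-u = i₀ , Fin.zero
    occupant at-v = i₀ , Fin.suc (proj₂ e₀)
    occupant (at-hub i) = hubOccupant (centreRole i)

    open Sources (_≢ e₀) (λ e → slotOccupant (leafRole e)) occupant slot labelB vertex

    leafRole-eS : swapped ≡ true → slotOccupant (leafRole eS) ≡ (i₁ , Fin.zero)
    leafRole-eS sw with leafRole eS
    ... | leaf-v eS≡e₀ = ⊥-elim (i₁-edge≢e₀ _ eS≡e₀)
    ... | leaf-hub _ _ = refl
    ... | leaf-slot _ unmoved = ⊥-elim (unmoved (sw , refl))

    centreRole-i₁ : swapped ≡ true → hubOccupant (centreRole i₁) ≡ (i₁ , Fin.suc (proj₂ eS))
    centreRole-i₁ sw with centreRole i₁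
    ... | centre-u i₁≡i₀ = ⊥-elim (i₀≢i₁ (sym i₁≡i₀))
    ... | centre-slot _ = refl
    ... | centre-hub _ unmoved = ⊥-elim (unmoved (sw , refl))

    source : ∀ w → Source w
    source (i , Fin.zero) with centreRole i in role
    ... | centre-u refl = viaB at-u refl (cong centreAt role)
    ... | centre-slot (sw , refl) = viaD eS (i₁-edge≢e₀ _) (sym (leafRole-eS sw)) (cong centreAt role)
    ... | centre-hub _ _ = viaB (at-hub i) (sym (cong hubOccupant role)) (cong centreAt role)
    source (i , Fin.suc y) with leafRole (i , y) in role
    ... | leaf-v refl = viaB at-v refl (cong leafAt role)
    ... | leaf-hub sw refl = viaB (at-hub i₁) (sym (centreRole-i₁ sw)) (cong leafAt role)
    ... | leaf-slot e≢e₀ _ = viaD (i , y) e≢e₀ (sym (cong slotOccupant role)) (cong leafAt role)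

    hubChoice-avoids : ∀ i → hub i ≢ toℕ u × hub i ≢ toℕ v
    hubChoice-avoids i = proj₂ (proj₂ (hubChoice i))

    labelB-injective : ∀ {b b'} → labelB b ≡ labelB b' → b ≡ b'
    labelB-injective {at-u} {at-u} _ = refl
    labelB-injective {at-v} {at-v} _ = refl
    labelB-injective {at-hub i} {at-hub i'} eq = cong at-hub (hub-injective eq)
    labelB-injective {at-u} {at-v} eq = ⊥-elim (u≢v (FinP.toℕ-injective eq))
    labelB-injective {at-v} {at-u} eq = ⊥-elim (u≢v (FinP.toℕ-injective (sym eq)))
    labelB-injective {at-u} {at-hub i} eq = ⊥-elim (proj₁ (hubChoice-avoids i) (sym eq))
    labelB-injective {at-hub i} {at-u} eq = ⊥-elim (proj₁ (hubChoice-avoids i) eq)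
    labelB-injective {at-v} {at-hub i} eq = ⊥-elim (proj₂ (hubChoice-avoids i) (sym eq))
    labelB-injective {at-hub i} {at-v} eq = ⊥-elim (proj₂ (hubChoice-avoids i) eq)

    labelB∈B : ∀ b → p ≤ labelB b
    labelB∈B at-u = proj₁ u,v∈B
    labelB∈B at-v = proj₂ u,v∈B
    labelB∈B (at-hub i) = hub∈B i

    labelB<n : ∀ b → labelB b < n
    labelB<n at-u = FinP.toℕ<n u
    labelB<n at-v = FinP.toℕ<n v
    labelB<n (at-hub i) = hub<n i

    vertex<n : ∀ w → vertex w < n
    vertex<n w with source w
    ... | viaD e e≢e₀ _ eq = subst (_< n) (sym eq) (<-trans (slot<p e≢e₀) p<n)
    ... | viaB b _ eq = subst (_< n) (sym eq) (labelB<n b)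

    -- Colours: a for e₀, p for eX (if swapped), the slot otherwise; a itself is a slot only if swapped, namely
    -- that of eX.
    a<p : swapped ≡ true → toℕ a < p
    a<p sw = subst (_< p) (swap-hits sw) (rotate-< (subst (_< p) position-eX (position<p (i₁-edge≢e₀ _))))

    a≢slot : ∀ {e} → e ≢ e₀ → ¬ (swapped ≡ true × e ≡ eX) → toℕ a ≢ slot e
    a≢slot {e} e≢e₀ not-eX eq with swapped?
    ... | yes sw = not-eX (sw , sym (slot-injective (i₁-edge≢e₀ _) e≢e₀ (begin
      slot eX           ≡⟨ cong rotate position-eX ⟩
      rotate (P + 1)    ≡⟨ swap-hits sw ⟩
      toℕ a             ≡⟨ eq ⟩
      slot e ∎)))
      where open ≡-Reasoning
    ... | no not-sw = <⇒≱ (slot<p e≢e₀) (subst (p ≤_) eq (plain-above (not-true not-sw)))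
      where
      not-true : ∀ {b} → ¬ (b ≡ true) → b ≡ false
      not-true {true} b≢true = ⊥-elim (b≢true refl)
      not-true {false} _ = refl

    colourAt-injective : ∀ {e e'} (ρ : ColourRole e) (ρ' : ColourRole e') → colourAt ρ ≡ colourAt ρ' → e ≡ e'
    colourAt-injective (colour-a e≡e₀) (colour-a e'≡e₀) _ = trans e≡e₀ (sym e'≡e₀)
    colourAt-injective (colour-p _ e≡eX) (colour-p _ e'≡eX) _ = trans e≡eX (sym e'≡eX)
    colourAt-injective (colour-slot e≢e₀ _) (colour-slot e'≢e₀ _) eq = slot-injective e≢e₀ e'≢e₀ eq
    colourAt-injective (colour-a _) (colour-p sw _) eq = ⊥-elim (<-irrefl eq (a<p sw))
    colourAt-injective (colour-p sw _) (colour-a _) eq = ⊥-elim (<-irrefl (sym eq) (a<p sw))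
    colourAt-injective (colour-a _) (colour-slot e'≢e₀ not-eX) eq = ⊥-elim (a≢slot e'≢e₀ not-eX eq)
    colourAt-injective (colour-slot e≢e₀ not-eX) (colour-a _) eq = ⊥-elim (a≢slot e≢e₀ not-eX (sym eq))
    colourAt-injective (colour-p _ _) (colour-slot e'≢e₀ _) eq = ⊥-elim (<-irrefl (sym eq) (slot<p e'≢e₀))
    colourAt-injective (colour-slot e≢e₀ _) (colour-p _ _) eq = ⊥-elim (<-irrefl eq (slot<p e≢e₀))

    colourAt<t : ∀ {e} (ρ : ColourRole e) → colourAt ρ < t
    colourAt<t (colour-a _) = FinP.toℕ<n a
    colourAt<t (colour-p _ _) = p<t
    colourAt<t (colour-slot e≢e₀ _) = <-trans (slot<p e≢e₀) p<t

    -- An edge of the moved star S i₁ other than eS joins the slot of eS to the slot j = toℕ y steps ahead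
    -- (1 ≤ j ≤ q); the cyclic colouring gives it colour p if j = 1 and the colour of its slot otherwise.
    moved-edge : ∀ y → (i₁ , y) ≢ eS →
                 (toℕ y ≡ 1 → splitColour (slot eS) (slot (i₁ , y)) ≡ just p) ×
                 (toℕ y ≢ 1 → splitColour (slot eS) (slot (i₁ , y)) ≡ just (slot (i₁ , y)))
    moved-edge y e≢eS = (λ j≡1 → trans in-clique (cong just (proj₁ coloured j≡1))) ,
                        (λ j≢1 → trans in-clique (cong just (proj₂ coloured j≢1)))
      where
      j = toℕ y
      e≢e₀ = i₁-edge≢e₀ y
      in-clique : splitColour (slot eS) (slot (i₁ , y)) ≡ just (cyclicColour (slot eS ⊓ slot (i₁ , y)) (slot eS ⊔ slot (i₁ , y)))
      in-clique = splitColour-DD (λ eq → e≢eS (sym (slot-injective (i₁-edge≢e₀ _) e≢e₀ eq))) (slot<p (i₁-edge≢e₀ _)) (slot<p e≢e₀)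
      1≤j : 1 ≤ j
      1≤j = n≢0⇒n>0 λ j≡0 → e≢eS (position-injective e≢e₀ (i₁-edge≢e₀ _)
                                   (trans (position-i₁ y) (trans (cong (P +_) j≡0) (+-identityʳ P))))
      j≤q : j ≤ q
      j≤q = s≤s⁻¹ (subst (j <_) s-i₁≡q+1 (FinP.toℕ<n y))
      ahead : slot (i₁ , y) ≡ slot eS + j ⊎ slot (i₁ , y) + p ≡ slot eS + j
      ahead = subst (λ z → rotate z ≡ slot eS + j ⊎ rotate z + p ≡ slot eS + j) (sym (position-i₁ y))
                    (rotate-step P j (subst (_< p) (position-i₁ y) (position<p e≢e₀)))
      coloured = cyclicColour-ahead (slot eS) (slot (i₁ , y)) j 1≤j j≤q ahead

    realise : ∀ {i y} (ρc : CentreRole i) (ρl : LeafRole (i , y)) (ρk : ColourRole (i , y)) →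
              (centreAt ρc ≡ toℕ u × leafAt ρl ≡ toℕ v × colourAt ρk ≡ toℕ a)
              ⊎ splitColour (centreAt ρc) (leafAt ρl) ≡ just (colourAt ρk)
    realise (centre-u _) (leaf-v _) (colour-a _) = inj₁ (refl , refl , refl)
    realise (centre-u _) (leaf-v e≡e₀) (colour-p _ e≡eX) = ⊥-elim (i₁-edge≢e₀ _ (trans (sym e≡eX) e≡e₀))
    realise (centre-u _) (leaf-v e≡e₀) (colour-slot e≢e₀ _) = ⊥-elim (e≢e₀ e≡e₀)
    realise (centre-u i≡i₀) (leaf-hub _ e≡eS) _ = ⊥-elim (i₀≢i₁ (trans (sym i≡i₀) (cong proj₁ e≡eS)))
    realise (centre-u _) (leaf-slot e≢e₀ _) (colour-a e≡e₀) = ⊥-elim (e≢e₀ e≡e₀)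
    realise (centre-u i≡i₀) (leaf-slot _ _) (colour-p _ e≡eX) = ⊥-elim (i₀≢i₁ (trans (sym i≡i₀) (cong proj₁ e≡eX)))
    realise (centre-u _) (leaf-slot e≢e₀ _) (colour-slot _ _) = inj₂ (splitColour-BD (proj₁ u,v∈B) (slot<p e≢e₀))
    realise (centre-slot (_ , i≡i₁)) (leaf-v e≡e₀) _ = ⊥-elim (i₀≢i₁ (trans (sym (cong proj₁ e≡e₀)) i≡i₁))
    realise (centre-slot _) (leaf-hub _ e≡eS) (colour-a e≡e₀) = ⊥-elim (i₁-edge≢e₀ _ (trans (sym e≡eS) e≡e₀))
    realise (centre-slot _) (leaf-hub _ e≡eS) (colour-p _ e≡eX) = ⊥-elim (eX≢eS (trans (sym e≡eX) e≡eS))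
    realise (centre-slot _) (leaf-hub _ e≡eS) (colour-slot _ _) =
      inj₂ (trans (splitColour-DB (slot<p (i₁-edge≢e₀ _)) (hub∈B i₁)) (cong (just ∘ slot) (sym e≡eS)))
    realise (centre-slot _) (leaf-slot e≢e₀ _) (colour-a e≡e₀) = ⊥-elim (e≢e₀ e≡e₀)
    realise {y = y} (centre-slot (_ , refl)) (leaf-slot e≢e₀ not-eS) (colour-p sw e≡eX) =
      inj₂ (proj₁ (moved-edge y (λ e≡eS → not-eS (sw , e≡eS))) (+-cancelˡ-≡ P _ _ (begin
        P + toℕ y        ≡⟨ sym (position-i₁ y) ⟩
        position (i₁ , y) ≡⟨ cong position e≡eX ⟩
        position eX      ≡⟨ position-eX ⟩
        P + 1 ∎)))
      where open ≡-Reasoning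
    realise {y = y} (centre-slot (sw , refl)) (leaf-slot e≢e₀ not-eS) (colour-slot _ not-eX) =
      inj₂ (proj₂ (moved-edge y (λ e≡eS → not-eS (sw , e≡eS))) λ j≡1 →
        not-eX (sw , position-injective e≢e₀ (i₁-edge≢e₀ _)
                       (trans (position-i₁ y) (trans (cong (P +_) j≡1) (sym position-eX)))))
    realise (centre-hub i≢i₀ _) (leaf-v e≡e₀) _ = ⊥-elim (i≢i₀ (cong proj₁ e≡e₀))
    realise (centre-hub _ unmoved) (leaf-hub sw e≡eS) _ = ⊥-elim (unmoved (sw , cong proj₁ e≡eS))
    realise (centre-hub _ _) (leaf-slot e≢e₀ _) (colour-a e≡e₀) = ⊥-elim (e≢e₀ e≡e₀)
    realise (centre-hub _ unmoved) (leaf-slot _ _) (colour-p sw e≡eX) = ⊥-elim (unmoved (sw , cong proj₁ e≡eX))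
    realise {i} (centre-hub _ _) (leaf-slot e≢e₀ _) (colour-slot _ _) = inj₂ (splitColour-BD (hub∈B i) (slot<p e≢e₀))

    realisation : Realisation s u v a
    realisation = record
      { vertex = vertex
      ; colour = colour
      ; vertex<n = vertex<n
      ; colour<t = λ e → colourAt<t (colourRole e)
      ; vertex-injective = sourced-injective p slot<p labelB∈B slot-injective labelB-injective source
      ; colour-injective = λ e e' → colourAt-injective (colourRole e) (colourRole e')
      ; realised = λ i y → realise (centreRole i) (leafRole (i , y)) (colourRole (i , y))
      }

  saturated : RainbowSaturated k s graph
  saturated = no-rainbow , add
    where
    P+1<p : P + 1 < p
    P+1<p = subst (_< p) position-eX (position<p (i₁-edge≢e₀ _))
    add : ∀ u v (u≢v : u ≢ v) → col graph u v ≡ nothing → ∀ a → HasRainbowCopy k s (addEdge graph u v u≢v a)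
    add u v u≢v uv∉G a with toℕ a <? p
    ... | yes a<p = let (r , r<p , hits) = rotation-to P+1<p a<p in
      realisation⇒rainbow u≢v uv∉G (Embedding.realisation u v u≢v uv∉G a true r<p (λ _ → hits) λ ())
    ... | no a≮p =
      realisation⇒rainbow u≢v uv∉G (Embedding.realisation u v u≢v uv∉G a false (≤-<-trans z≤n P+1<p) (λ ()) λ _ → ≮⇒≥ a≮p)

LinearlySaturable : (k : ℕ) → (Fin k → ℕ) → ℕ → Set
LinearlySaturable k s t =
  Σ ℕ λ C → Σ ℕ λ N → ∀ (n : ℕ) → N ≤ n → Σ (ColGraph n t) λ G → RainbowSaturated k s G × edgeCount G ≤ C * n

-- The constructions live on n = n' + 1 vertices; a positive threshold N covers all n ≥ N.
from-positive : ∀ {X : ℕ → Set} N → 1 ≤ N → (∀ n' → N ≤ suc n' → X (suc n')) → ∀ n → N ≤ n → X n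
from-positive N 1≤N build zero N≤0 = ⊥-elim (<⇒≱ 1≤N N≤0)
from-positive N 1≤N build (suc n') N≤n = build n' N≤n

single-edge-star-case : ∀ k' (s : Fin (suc k') → ℕ) → (∀ i → 1 ≤ s i) → ∀ i₀ → s i₀ ≡ 1 →
                        ∀ t' → edges (suc k') s ≤ suc t' → LinearlySaturable (suc k') s (suc t')
single-edge-star-case k' s s≥1 i₀ s-i₀≡1 t' e≤t = k' , (k' + 3) * suc t' , from-positive _ 1≤N λ n' n-large →
  let open SingleEdgeStar k' s s≥1 i₀ s-i₀≡1 t' e≤t n' n-large in graph , saturated , graph-edgeCount
  where
  1≤N : 1 ≤ (k' + 3) * suc t'
  1≤N = ≤-trans (≤-trans (s≤s z≤n) (m≤n+m 3 k')) (m≤m*n (k' + 3) (suc t'))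

ordered-pair : ∀ {k''} (s : Fin (suc (suc k'')) → ℕ) →
               Σ (Fin (suc (suc k''))) λ i₀ → Σ (Fin (suc (suc k''))) λ i₁ → i₀ ≢ i₁ × s i₁ ≤ s i₀
ordered-pair s with s (Fin.suc Fin.zero) ≤? s Fin.zero
... | yes s₁≤s₀ = Fin.zero , Fin.suc Fin.zero , (λ ()) , s₁≤s₀
... | no s₁≰s₀ = Fin.suc Fin.zero , Fin.zero , (λ ()) , <⇒≤ (≰⇒> s₁≰s₀)

large-stars-case : ∀ k'' (s : Fin (suc (suc k'')) → ℕ) → (∀ i → 2 ≤ s i) →
                   ∀ t' → edges (suc (suc k'')) s ≤ suc t' → LinearlySaturable (suc (suc k'')) s (suc t')
large-stars-case k'' s s≥2 t' e≤t with ordered-pair s | edges (suc (suc k'')) s in edges≡ | e≤t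
... | i₀ , i₁ , i₀≢i₁ , s-i₁≤s-i₀ | suc p | p<t =
  p , p + 3 * suc (suc k'') , from-positive _ (≤-trans (s≤s z≤n) (m≤n+m _ p)) λ n' n-large →
    let open LargeStars (suc k'') s s≥2 i₀ i₁ i₀≢i₁ s-i₁≤s-i₀ t' p edges≡ p<t n' n-large in graph , saturated , graph-edgeCount
... | _ | zero | _ = ⊥-elim (<⇒≱ (≤-trans (s≥2 Fin.zero) (m≤m+n _ _)) (≤-trans (≤-reflexive edges≡) z≤n))

two-leaves : ∀ {m} → 1 ≤ m → m ≢ 1 → 2 ≤ m
two-leaves {suc zero} _ m≢1 = ⊥-elim (m≢1 refl)
two-leaves {suc (suc _)} _ _ = s≤s (s≤s z≤n)

-- Since t ≥ e(H) > 0, t is positive; then either some star is a single edge or all have two leaves.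
proposition4p3 : (k : ℕ) → 2 ≤ k → (s : Fin k → ℕ) → (∀ i → 1 ≤ s i) →
    (t : ℕ) → eH k s ≤ t →
    Σ ℕ λ C → Σ ℕ λ N → ∀ (n : ℕ) → N ≤ n →
      Σ (ColGraph n t) λ G → RainbowSaturated k s G × edgeCount G ≤ C * n
proposition4p3 (suc (suc k'')) (s≤s (s≤s z≤n)) s s≥1 zero eH≤0 =
  ⊥-elim (<⇒≱ (≤-trans (s≥1 Fin.zero) (m≤m+n _ _)) (subst (_≤ 0) (eH≡edges _ s) eH≤0))
proposition4p3 (suc (suc k'')) (s≤s (s≤s z≤n)) s s≥1 (suc t') eH≤t with FinP.any? (λ i → s i ≟ 1)
... | yes (i₀ , s-i₀≡1) = single-edge-star-case (suc k'') s s≥1 i₀ s-i₀≡1 t' e≤t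
  where e≤t = subst (_≤ suc t') (eH≡edges _ s) eH≤t
... | no no-single-edge = large-stars-case k'' s (λ i → two-leaves (s≥1 i) (no-single-edge ∘ (i ,_))) t' e≤t
  where e≤t = subst (_≤ suc t') (eH≡edges _ s) eH≤t
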